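{- Let $q\geqslant2$ be an even integer and $n\geqslant1$. There is no self-dual generalized bent function $f:\mathbb{F}_2^n\to\mathbb{Z}_q$ of the form $f(x)=\sum_{i=1}^n\lambda_ix_i+\lambda_0$ with $\lambda_0,\lambda_1,\dots,\lambda_n\in\mathbb{Z}_q$.
   Context: $x_i\in\{0,1\}$ are treated as integers in the sum. $\omega=e^{2\pi i/q}$, $H_f(y)=\sum_x\omega^{f(x)}(-1)^{\langle x,y\rangle}$ with $\langle x,y\rangle=\bigoplus_ix_iy_i$. $f$ is self-dual generalized bent if $H_f(y)=2^{n/2}\omega^{f(y)}$ for all $y\in\mathbb{F}_2^n$. -}

module Defs where

open import Data.Nat as ℕ using (ℕ; zero; suc; NonZero)
open import Data.Nat.DivMod using (_mod_)
open import Data.Nat.Divisibility using (_∣?_)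
open import Data.Nat.Primality using (prime?)
open import Data.Integer as ℤ using (ℤ; +_; -_)
open import Data.Fin using (Fin; toℕ) renaming (zero to Fz; suc to Fs)
open import Data.Bool using (Bool; true; false; if_then_else_; _∧_; _xor_)
open import Data.List using (List; []; _∷_; _++_; replicate; foldr; map; concatMap; upTo)
open import Data.Vec.Functional using (Vector) renaming (_∷_ to _∷ᵛ_)
open import Data.Product using (∃)
open import Relation.Nullary using (does)
open import Relation.Binary.PropositionalEquality using (_≡_)

-- Integer polynomials (coefficient lists, lowest degree first)

Poly : Set
Poly = List ℤ

_⊕_ : Poly → Poly → Poly
[] ⊕ q = q
(a ∷ p) ⊕ [] = a ∷ p
(a ∷ p) ⊕ (b ∷ q) = (a ℤ.+ b) ∷ (p ⊕ q)

negP : Poly → Poly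
negP = map (-_)

_⊛_ : Poly → Poly → Poly
[] ⊛ q = []
(a ∷ p) ⊛ q = map (a ℤ.*_) q ⊕ (+ 0 ∷ (p ⊛ q))

mono : ℕ → Poly
mono k = replicate k (+ 0) ++ (+ 1 ∷ [])

_^ₚ_ : Poly → ℕ → Poly
p ^ₚ zero = mono 0
p ^ₚ suc n = p ⊛ (p ^ₚ n)

coeff : Poly → ℕ → ℤ
coeff [] k = + 0
coeff (a ∷ p) zero = a
coeff (a ∷ p) (suc k) = coeff p k

XdMinus1 : ℕ → Poly
XdMinus1 d = mono d ⊕ negP (mono 0)

μ : ℕ → ℤ
μ m = foldr step (+ 1) (upTo (suc m))
  where
  step : ℕ → ℤ → ℤ
  step p acc = if does (prime? p) ∧ does (p ∣? m)
               then (if does ((p ℕ.* p) ∣? m) then + 0 else - (+ 1)) ℤ.* acc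
               else acc

-- Φ_N(X) = ∏_{d ∣ N} (X^d - 1)^{μ(N/d)}, i.e. Φ_N · cycDen N = cycNum N
-- with cycNum N = ∏_{d∣N, μ(N/d)=1} (X^d-1), cycDen N = ∏_{d∣N, μ(N/d)=-1} (X^d-1).
cycFactors : ℤ → ℕ → Poly
cycFactors s N = foldr step (mono 0) (upTo N)
  where
  step : ℕ → Poly → Poly
  step d' acc = if does (suc d' ∣? N) ∧ does (μ (N ℕ./ suc d') ℤ.≟ s)
                then XdMinus1 (suc d') ⊛ acc
                else acc

cycNum cycDen : ℕ → Poly
cycNum = cycFactors (+ 1)
cycDen = cycFactors (- (+ 1))

-- p(ζ_N) = 0 in ℂ, where ζ_N = e^{2πi/N}; equivalently Φ_N ∣ p in ℤ[X],
-- i.e. p · cycDen N = g · cycNum N for some g ∈ ℤ[X].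
VanishesAtζ : ℕ → Poly → Set
VanishesAtζ N p = ∃ λ (g : Poly) → ∀ k → coeff (p ⊛ cycDen N) k ≡ coeff (g ⊛ cycNum N) k

allVecs : (n : ℕ) → List (Vector Bool n)
allVecs zero = (λ ()) ∷ []
allVecs (suc n) = concatMap (λ v → (false ∷ᵛ v) ∷ (true ∷ᵛ v) ∷ []) (allVecs n)

inner : (n : ℕ) → Vector Bool n → Vector Bool n → Bool
inner zero x y = false
inner (suc n) x y = (x Fz ∧ y Fz) xor inner n (λ i → x (Fs i)) (λ i → y (Fs i))

bit : Bool → ℕ
bit true = 1
bit false = 0

-- Everything is computed in ℤ[ζ] with ζ = e^{2πi/(8q)}:
--   ω = ζ^8,  -1 = ζ^{4q},  √2 = ζ^q + ζ^{7q}  (= 2 cos(π/4) > 0).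

-- Walsh–Hadamard transform H_f(y) = Σ_x ω^{f(x)} (-1)^{⟨x,y⟩}, as an element of ℤ[X]
walsh : (q n : ℕ) → (Vector Bool n → Fin q) → Vector Bool n → Poly
walsh q n f y = foldr (λ x acc → mono (8 ℕ.* toℕ (f x) ℕ.+ 4 ℕ.* q ℕ.* bit (inner n x y)) ⊕ acc)
                      [] (allVecs n)

sqrt2 : ℕ → Poly
sqrt2 q = mono q ⊕ mono (7 ℕ.* q)

selfDualRHS : (q n : ℕ) → (Vector Bool n → Fin q) → Vector Bool n → Poly
selfDualRHS q n f y = (sqrt2 q ^ₚ n) ⊛ mono (8 ℕ.* toℕ (f y))

-- f is self-dual generalized bent: H_f(y) = 2^{n/2} ω^{f(y)} in ℂ for all y
SelfDualGBent : (q n : ℕ) → (Vector Bool n → Fin q) → Set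
SelfDualGBent q n f =
  ∀ y → VanishesAtζ (8 ℕ.* q) (walsh q n f y ⊕ negP (selfDualRHS q n f y))

sumFin : (n : ℕ) → (Fin n → ℕ) → ℕ
sumFin zero g = 0
sumFin (suc n) g = g Fz ℕ.+ sumFin n (λ i → g (Fs i))

affine : (q n : ℕ) .{{_ : NonZero q}} → Fin q → (Fin n → Fin q) → Vector Bool n → Fin q
affine q n λ₀ λs x = (sumFin n (λ i → toℕ (λs i) ℕ.* bit (x i)) ℕ.+ toℕ λ₀) mod q

{-# OPTIONS --safe #-}
module Submission where

-- Work in ℤ[X] modulo the polynomials vanishing at ζ = e^(2πi/8q), so that ω = ζ⁸, −1 = ζ^(4q) and
-- √2 = ζ^q + ζ^(7q).  For affine f, write w = ω^λ₁ and A = Σ_v ω^(λ₂v₂ + ⋯ + λₙvₙ + λ₀).  The Walsh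
-- values at y = 0 and y = e₁ are (1 + w)A and (1 − w)A, while self-duality makes them √2ⁿω^λ₀ and
-- √2ⁿω^λ₀w; eliminating A and cancelling the units √2ⁿ and ω^λ₀ leaves (1 + w)² = 2, so w = −1 ± √2.
-- Since q = 2k is even, w^(2k) = 1.  But the even powers w^(2j) = a_j − b_j(1 + w) follow the Pell
-- recursion with a_j² − 2b_j² = 1, so w^(2k) = 1 would make (a_k − 1)² − 2b_k² = 2 − 2a_k, a nonzero
-- integer, vanish at ζ.

open import Level using (_⊔_)
open import Algebra.Bundles using (CommutativeRing; Ring)
open import Relation.Binary.Bundles using (Setoid)
import Algebra.Properties.AbelianGroup as AbelianGroupProperties
import Algebra.Properties.CommutativeSemigroup as CommutativeSemigroupProperties
import Algebra.Properties.Ring as RingProperties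
import Algebra.Properties.RingWithoutOne as RingWithoutOneProperties
import Relation.Binary.Reasoning.Setoid as SetoidReasoning

record IsIdeal {c ℓ i} (R : CommutativeRing c ℓ) (I : CommutativeRing.Carrier R → Set i)
       : Set (c ⊔ ℓ ⊔ i) where
  open CommutativeRing R
  field
    ∈-resp    : ∀ {x y} → x ≈ y → I x → I y
    0∈        : I 0#
    +-closed  : ∀ {x y} → I x → I y → I (x + y)
    *-closedˡ : ∀ a {x} → I x → I (a * x)

module Quotient {c ℓ i} (R : CommutativeRing c ℓ) {I : CommutativeRing.Carrier R → Set i}
                (isIdeal : IsIdeal R I) where

  open CommutativeRing R
  open IsIdeal isIdeal
  open AbelianGroupProperties +-abelianGroup using (⁻¹-anti-homo‿-; ⁻¹-∙-comm; x≈y⇒x∙y⁻¹≈ε)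
  open CommutativeSemigroupProperties +-commutativeSemigroup using (interchange)
  open RingProperties ring using (-1*x≈-x)
  open RingWithoutOneProperties (Ring.ringWithoutOne ring) using (x[y-z]≈xy-xz; [y-z]x≈yx-zx)

  infix 4 _≋_
  record _≋_ (x y : Carrier) : Set i where
    constructor mk≋
    field difference∈ : I (x - y)
  open _≋_ public

  -‿closed : ∀ {x} → I x → I (- x)
  -‿closed {x} x∈ = ∈-resp (-1*x≈-x x) (*-closedˡ (- 1#) x∈)

  ≈⇒≋ : ∀ {x y} → x ≈ y → x ≋ y
  ≈⇒≋ x≈y = mk≋ (∈-resp (sym (x≈y⇒x∙y⁻¹≈ε x≈y)) 0∈)

  ≋-refl : ∀ {x} → x ≋ x
  ≋-refl = ≈⇒≋ refl

  ≋-sym : ∀ {x y} → x ≋ y → y ≋ x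
  ≋-sym {x} {y} (mk≋ x-y∈) = mk≋ (∈-resp (⁻¹-anti-homo‿- x y) (-‿closed x-y∈))

  ≋-trans : ∀ {x y z} → x ≋ y → y ≋ z → x ≋ z
  ≋-trans {x} {y} {z} (mk≋ x-y∈) (mk≋ y-z∈) = mk≋ (∈-resp telescope (+-closed x-y∈ y-z∈))
    where
    open SetoidReasoning setoid
    telescope : (x - y) + (y - z) ≈ x - z
    telescope = begin
      (x - y) + (y - z)   ≈⟨ +-assoc x (- y) (y - z) ⟩
      x + (- y + (y - z)) ≈⟨ +-congˡ (+-assoc (- y) y (- z)) ⟨
      x + ((- y + y) - z) ≈⟨ +-congˡ (+-congʳ (-‿inverseˡ y)) ⟩
      x + (0# - z)        ≈⟨ +-congˡ (+-identityˡ (- z)) ⟩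
      x - z               ∎

  +-cong-≋ : ∀ {x x′ y y′} → x ≋ x′ → y ≋ y′ → x + y ≋ x′ + y′
  +-cong-≋ {x} {x′} {y} {y′} (mk≋ x-x′∈) (mk≋ y-y′∈) =
    mk≋ (∈-resp regroup (+-closed x-x′∈ y-y′∈))
    where
    open SetoidReasoning setoid
    regroup : (x - x′) + (y - y′) ≈ (x + y) - (x′ + y′)
    regroup = begin
      (x - x′) + (y - y′)     ≈⟨ interchange x (- x′) y (- y′) ⟩
      (x + y) + (- x′ - y′)   ≈⟨ +-congˡ (⁻¹-∙-comm x′ y′) ⟩
      (x + y) - (x′ + y′)     ∎

  *-congʳ-≋ : ∀ {x x′} y → x ≋ x′ → x * y ≋ x′ * y
  *-congʳ-≋ {x} {x′} y (mk≋ x-x′∈) =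
    mk≋ (∈-resp (trans (*-comm y (x - x′)) ([y-z]x≈yx-zx y x x′)) (*-closedˡ y x-x′∈))

  *-congˡ-≋ : ∀ x {y y′} → y ≋ y′ → x * y ≋ x * y′
  *-congˡ-≋ x {y} {y′} (mk≋ y-y′∈) = mk≋ (∈-resp (x[y-z]≈xy-xz x y y′) (*-closedˡ x y-y′∈))

  *-cong-≋ : ∀ {x x′ y y′} → x ≋ x′ → y ≋ y′ → x * y ≋ x′ * y′
  *-cong-≋ {x′ = x′} {y = y} x≋x′ y≋y′ = ≋-trans (*-congʳ-≋ y x≋x′) (*-congˡ-≋ x′ y≋y′)

  -‿cong-≋ : ∀ {x x′} → x ≋ x′ → - x ≋ - x′
  -‿cong-≋ {x} {x′} x≋x′ = ≋-trans (≈⇒≋ (sym (-1*x≈-x x)))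
    (≋-trans (*-congˡ-≋ (- 1#) x≋x′) (≈⇒≋ (-1*x≈-x x′)))

  ≋-setoid : Setoid c i
  ≋-setoid = record
    { Carrier = Carrier
    ; _≈_ = _≋_
    ; isEquivalence = record { refl = ≋-refl ; sym = ≋-sym ; trans = ≋-trans }
    }

  module ≋-Reasoning = SetoidReasoning ≋-setoid

open import Defs
open import Level using (0ℓ)
open import Data.Nat.Base as ℕ using (ℕ; zero; suc; _+_; _*_; _∸_; _^_; _<_; _≤_; s≤s; z≤n; NonZero; nonTrivial⇒n>1)
import Data.Nat.Properties as ℕP
open import Data.Nat.DivMod using (_mod_; _%_; _/_; m≡m%n+[m/n]*n; m%n<n; n/n≡1)
open import Data.Nat.Divisibility
open import Data.Nat.Induction using (<-wellFounded)
open import Data.Nat.ListAction using (product)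
open import Data.Nat.Primality
  using (Prime; prime?; euclidsLemma; prime⇒irreducible; prime⇒nonTrivial; prime⇒nonZero; ¬prime[0]; ¬prime[1]; prime[2])
open import Data.Nat.Primality.Factorisation using (factorise)
import Data.Nat.Tactic.RingSolver as ℕ-Solver
open import Data.Integer.Base as ℤ using (ℤ; +_; -_)
import Data.Integer.Properties as ℤP
import Data.Integer.Tactic.RingSolver as ℤ-Solver
open import Data.Fin.Base using (Fin; toℕ) renaming (zero to Fz; suc to Fs)
import Data.Fin.Properties as FinP
open import Data.Bool.Base using (Bool; true; false; if_then_else_; _∧_; _xor_)
open import Data.Bool.Properties using (∧-zeroʳ; xor-identityʳ)
open import Data.List.Base using (List; []; _∷_; map; foldr; concatMap; upTo)
open import Data.List.Membership.Propositional using (_∈_)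
open import Data.List.Membership.Propositional.Properties using (∈-upTo⁺)
open import Data.List.Relation.Unary.All using (_∷_)
open import Data.List.Relation.Unary.Any using (here; there)
open import Data.Maybe.Base as Maybe using (Maybe; just; nothing)
open import Data.Vec.Functional using (Vector) renaming (_∷_ to _∷ᵛ_)
open import Data.Product.Base using (∃; ∃₂; _×_; _,_; proj₁; proj₂)
open import Data.Sum.Base using (_⊎_; inj₁; inj₂)
open import Data.Empty using (⊥-elim)
open import Function.Base using (_∘_; case_of_)
open import Induction.WellFounded using (Acc; acc)
open import Relation.Nullary using (¬_; Dec; yes; no; does)
open import Relation.Binary.PropositionalEquality
open import Tactic.RingSolver using (solve-∀)
open import Tactic.RingSolver.Core.AlmostCommutativeRing using (AlmostCommutativeRing; fromCommutativeRing)

infix 4 _≈_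
record _≈_ (p q : Poly) : Set where
  constructor coeffwise
  field coeff-≡ : ∀ k → coeff p k ≡ coeff q k
open _≈_ public

≈-refl : ∀ {p} → p ≈ p
≈-refl = coeffwise λ _ → refl

≈-reflexive : ∀ {p q} → p ≡ q → p ≈ q
≈-reflexive refl = ≈-refl

≈-sym : ∀ {p q} → p ≈ q → q ≈ p
≈-sym e = coeffwise λ k → sym (coeff-≡ e k)

≈-trans : ∀ {p q r} → p ≈ q → q ≈ r → p ≈ r
≈-trans e f = coeffwise λ k → trans (coeff-≡ e k) (coeff-≡ f k)

scale : ℤ → Poly → Poly
scale a = map (a ℤ.*_)

coeff-⊕ : ∀ p q k → coeff (p ⊕ q) k ≡ coeff p k ℤ.+ coeff q k
coeff-⊕ []      q       k       = sym (ℤP.+-identityˡ _)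
coeff-⊕ (a ∷ p) []      k       = sym (ℤP.+-identityʳ _)
coeff-⊕ (a ∷ p) (b ∷ q) zero    = refl
coeff-⊕ (a ∷ p) (b ∷ q) (suc k) = coeff-⊕ p q k

coeff-negP : ∀ p k → coeff (negP p) k ≡ - coeff p k
coeff-negP []      k       = refl
coeff-negP (a ∷ p) zero    = refl
coeff-negP (a ∷ p) (suc k) = coeff-negP p k

coeff-scale : ∀ a p k → coeff (scale a p) k ≡ a ℤ.* coeff p k
coeff-scale a []      k       = sym (ℤP.*-zeroʳ a)
coeff-scale a (b ∷ p) zero    = refl
coeff-scale a (b ∷ p) (suc k) = coeff-scale a p k

coeff-∷⊛ : ∀ a p q k → coeff ((a ∷ p) ⊛ q) k ≡ a ℤ.* coeff q k ℤ.+ coeff (+ 0 ∷ p ⊛ q) k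
coeff-∷⊛ a p q k = trans (coeff-⊕ (scale a q) _ k) (cong (ℤ._+ coeff (+ 0 ∷ p ⊛ q) k) (coeff-scale a q k))

∷-cong : ∀ {a b p q} → a ≡ b → p ≈ q → a ∷ p ≈ b ∷ q
∷-cong a≡b p≈q = coeffwise λ { zero → a≡b ; (suc k) → coeff-≡ p≈q k }

0∷-≈[] : ∀ {p} → p ≈ [] → + 0 ∷ p ≈ []
0∷-≈[] p≈[] = coeffwise λ { zero → refl ; (suc k) → coeff-≡ p≈[] k }

⊕-cong : ∀ {p p′ q q′} → p ≈ p′ → q ≈ q′ → p ⊕ q ≈ p′ ⊕ q′
⊕-cong {p} {p′} {q} {q′} e f = coeffwise λ k → begin
  coeff (p ⊕ q) k             ≡⟨ coeff-⊕ p q k ⟩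
  coeff p k ℤ.+ coeff q k     ≡⟨ cong₂ ℤ._+_ (coeff-≡ e k) (coeff-≡ f k) ⟩
  coeff p′ k ℤ.+ coeff q′ k   ≡⟨ coeff-⊕ p′ q′ k ⟨
  coeff (p′ ⊕ q′) k           ∎
  where open ≡-Reasoning

negP-cong : ∀ {p p′} → p ≈ p′ → negP p ≈ negP p′
negP-cong {p} {p′} e = coeffwise λ k →
  trans (coeff-negP p k) (trans (cong -_ (coeff-≡ e k)) (sym (coeff-negP p′ k)))

scale-cong : ∀ a {p p′} → p ≈ p′ → scale a p ≈ scale a p′
scale-cong a {p} {p′} e = coeffwise λ k →
  trans (coeff-scale a p k) (trans (cong (a ℤ.*_) (coeff-≡ e k)) (sym (coeff-scale a p′ k)))

⊕-comm : ∀ p q → p ⊕ q ≈ q ⊕ p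
⊕-comm p q = coeffwise λ k →
  trans (coeff-⊕ p q k) (trans (ℤP.+-comm (coeff p k) _) (sym (coeff-⊕ q p k)))

⊕-assoc : ∀ p q r → (p ⊕ q) ⊕ r ≈ p ⊕ (q ⊕ r)
⊕-assoc p q r = coeffwise λ k → begin
  coeff ((p ⊕ q) ⊕ r) k                        ≡⟨ coeff-⊕ (p ⊕ q) r k ⟩
  coeff (p ⊕ q) k ℤ.+ coeff r k                ≡⟨ cong (ℤ._+ coeff r k) (coeff-⊕ p q k) ⟩
  coeff p k ℤ.+ coeff q k ℤ.+ coeff r k        ≡⟨ ℤP.+-assoc (coeff p k) _ _ ⟩
  coeff p k ℤ.+ (coeff q k ℤ.+ coeff r k)      ≡⟨ cong (ℤ._+_ (coeff p k)) (coeff-⊕ q r k) ⟨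
  coeff p k ℤ.+ coeff (q ⊕ r) k                ≡⟨ coeff-⊕ p (q ⊕ r) k ⟨
  coeff (p ⊕ (q ⊕ r)) k                        ∎
  where open ≡-Reasoning

⊕-identityˡ : ∀ p → [] ⊕ p ≈ p
⊕-identityˡ p = ≈-refl

⊕-identityʳ : ∀ p → p ⊕ [] ≈ p
⊕-identityʳ p = coeffwise λ k → trans (coeff-⊕ p [] k) (ℤP.+-identityʳ _)

⊕-inverseˡ : ∀ p → negP p ⊕ p ≈ []
⊕-inverseˡ p = coeffwise λ k → begin
  coeff (negP p ⊕ p) k            ≡⟨ coeff-⊕ (negP p) p k ⟩
  coeff (negP p) k ℤ.+ coeff p k  ≡⟨ cong (ℤ._+ coeff p k) (coeff-negP p k) ⟩
  - coeff p k ℤ.+ coeff p k       ≡⟨ ℤP.+-inverseˡ (coeff p k) ⟩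
  + 0                             ∎
  where open ≡-Reasoning

⊕-inverseʳ : ∀ p → p ⊕ negP p ≈ []
⊕-inverseʳ p = ≈-trans (⊕-comm p (negP p)) (⊕-inverseˡ p)

⊕-interchange : ∀ p q r s → (p ⊕ q) ⊕ (r ⊕ s) ≈ (p ⊕ r) ⊕ (q ⊕ s)
⊕-interchange p q r s = coeffwise λ k → begin
  coeff ((p ⊕ q) ⊕ (r ⊕ s)) k
    ≡⟨ coeff-⊕ (p ⊕ q) _ k ⟩
  coeff (p ⊕ q) k ℤ.+ coeff (r ⊕ s) k
    ≡⟨ cong₂ ℤ._+_ (coeff-⊕ p q k) (coeff-⊕ r s k) ⟩
  (coeff p k ℤ.+ coeff q k) ℤ.+ (coeff r k ℤ.+ coeff s k)
    ≡⟨ interchange (coeff p k) _ _ _ ⟩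
  (coeff p k ℤ.+ coeff r k) ℤ.+ (coeff q k ℤ.+ coeff s k)
    ≡⟨ cong₂ ℤ._+_ (coeff-⊕ p r k) (coeff-⊕ q s k) ⟨
  coeff (p ⊕ r) k ℤ.+ coeff (q ⊕ s) k
    ≡⟨ coeff-⊕ (p ⊕ r) _ k ⟨
  coeff ((p ⊕ r) ⊕ (q ⊕ s)) k ∎
  where
  open ≡-Reasoning
  interchange : ∀ x y z w → (x ℤ.+ y) ℤ.+ (z ℤ.+ w) ≡ (x ℤ.+ z) ℤ.+ (y ℤ.+ w)
  interchange = ℤ-Solver.solve-∀

scale-distribʳ : ∀ a b p → scale (a ℤ.+ b) p ≈ (scale a p) ⊕ (scale b p)
scale-distribʳ a b p = coeffwise λ k → begin
  coeff (scale (a ℤ.+ b) p) k                  ≡⟨ coeff-scale (a ℤ.+ b) p k ⟩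
  (a ℤ.+ b) ℤ.* coeff p k                      ≡⟨ ℤP.*-distribʳ-+ (coeff p k) a b ⟩
  a ℤ.* coeff p k ℤ.+ b ℤ.* coeff p k          ≡⟨ cong₂ ℤ._+_ (coeff-scale a p k) (coeff-scale b p k) ⟨
  coeff (scale a p) k ℤ.+ coeff (scale b p) k  ≡⟨ coeff-⊕ (scale a p) _ k ⟨
  coeff (scale a p ⊕ scale b p) k              ∎
  where open ≡-Reasoning

scale-distribˡ : ∀ a p q → scale a (p ⊕ q) ≈ (scale a p) ⊕ (scale a q)
scale-distribˡ a p q = coeffwise λ k → begin
  coeff (scale a (p ⊕ q)) k                    ≡⟨ coeff-scale a (p ⊕ q) k ⟩
  a ℤ.* coeff (p ⊕ q) k                        ≡⟨ cong (a ℤ.*_) (coeff-⊕ p q k) ⟩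
  a ℤ.* (coeff p k ℤ.+ coeff q k)              ≡⟨ ℤP.*-distribˡ-+ a (coeff p k) _ ⟩
  a ℤ.* coeff p k ℤ.+ a ℤ.* coeff q k          ≡⟨ cong₂ ℤ._+_ (coeff-scale a p k) (coeff-scale a q k) ⟨
  coeff (scale a p) k ℤ.+ coeff (scale a q) k  ≡⟨ coeff-⊕ (scale a p) _ k ⟨
  coeff (scale a p ⊕ scale a q) k              ∎
  where open ≡-Reasoning

scale-* : ∀ a b p → scale (a ℤ.* b) p ≈ scale a (scale b p)
scale-* a b p = coeffwise λ k → begin
  coeff (scale (a ℤ.* b) p) k    ≡⟨ coeff-scale (a ℤ.* b) p k ⟩
  a ℤ.* b ℤ.* coeff p k          ≡⟨ ℤP.*-assoc a b _ ⟩
  a ℤ.* (b ℤ.* coeff p k)        ≡⟨ cong (a ℤ.*_) (coeff-scale b p k) ⟨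
  a ℤ.* coeff (scale b p) k      ≡⟨ coeff-scale a (scale b p) k ⟨
  coeff (scale a (scale b p)) k  ∎
  where open ≡-Reasoning

scale-zero : ∀ p → scale (+ 0) p ≈ []
scale-zero p = coeffwise λ k → trans (coeff-scale (+ 0) p k) (ℤP.*-zeroˡ (coeff p k))

⊛-zeroʳ : ∀ p → p ⊛ [] ≈ []
⊛-zeroʳ []      = ≈-refl
⊛-zeroʳ (a ∷ p) = 0∷-≈[] (⊛-zeroʳ p)

⊛-congʳ : ∀ p {q q′} → q ≈ q′ → p ⊛ q ≈ p ⊛ q′
⊛-congʳ []      e = ≈-refl
⊛-congʳ (a ∷ p) e = ⊕-cong (scale-cong a e) (∷-cong refl (⊛-congʳ p e))

⊛-consʳ : ∀ p b q → p ⊛ (b ∷ q) ≈ (scale b p) ⊕ (+ 0 ∷ p ⊛ q)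
⊛-consʳ p b q = coeffwise (go p)
  where
  go : ∀ p k → coeff (p ⊛ (b ∷ q)) k ≡ coeff (scale b p ⊕ (+ 0 ∷ p ⊛ q)) k
  go []      zero    = refl
  go []      (suc k) = refl
  go (a ∷ p) zero    = begin
    coeff ((a ∷ p) ⊛ (b ∷ q)) zero  ≡⟨ coeff-∷⊛ a p (b ∷ q) zero ⟩
    a ℤ.* b ℤ.+ + 0                 ≡⟨ cong (ℤ._+ + 0) (ℤP.*-comm a b) ⟩
    b ℤ.* a ℤ.+ + 0                 ∎
    where open ≡-Reasoning
  go (a ∷ p) (suc k) = begin
    coeff ((a ∷ p) ⊛ (b ∷ q)) (suc k)
      ≡⟨ coeff-∷⊛ a p (b ∷ q) (suc k) ⟩
    a ℤ.* coeff q k ℤ.+ coeff (p ⊛ (b ∷ q)) k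
      ≡⟨ cong (ℤ._+_ (a ℤ.* coeff q k)) (trans (go p k) (coeff-⊕ (scale b p) _ k)) ⟩
    a ℤ.* coeff q k ℤ.+ (coeff (scale b p) k ℤ.+ coeff (+ 0 ∷ p ⊛ q) k)
      ≡⟨ cong (λ c → a ℤ.* coeff q k ℤ.+ (c ℤ.+ coeff (+ 0 ∷ p ⊛ q) k)) (coeff-scale b p k) ⟩
    a ℤ.* coeff q k ℤ.+ (b ℤ.* coeff p k ℤ.+ coeff (+ 0 ∷ p ⊛ q) k)
      ≡⟨ exchange (a ℤ.* coeff q k) (b ℤ.* coeff p k) _ ⟩
    b ℤ.* coeff p k ℤ.+ (a ℤ.* coeff q k ℤ.+ coeff (+ 0 ∷ p ⊛ q) k)
      ≡⟨ cong (ℤ._+_ (b ℤ.* coeff p k)) (coeff-∷⊛ a p q k) ⟨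
    b ℤ.* coeff p k ℤ.+ coeff ((a ∷ p) ⊛ q) k
      ≡⟨ cong (ℤ._+ coeff ((a ∷ p) ⊛ q) k) (coeff-scale b p k) ⟨
    coeff (scale b p) k ℤ.+ coeff ((a ∷ p) ⊛ q) k
      ≡⟨ coeff-⊕ (scale b p) _ k ⟨
    coeff (scale b (a ∷ p) ⊕ (+ 0 ∷ (a ∷ p) ⊛ q)) (suc k) ∎
    where
    open ≡-Reasoning
    exchange : ∀ x y z → x ℤ.+ (y ℤ.+ z) ≡ y ℤ.+ (x ℤ.+ z)
    exchange = ℤ-Solver.solve-∀

⊛-comm : ∀ p q → p ⊛ q ≈ q ⊛ p
⊛-comm []      q = ≈-sym (⊛-zeroʳ q)
⊛-comm (a ∷ p) q = ≈-trans (⊕-cong ≈-refl (∷-cong refl (⊛-comm p q))) (≈-sym (⊛-consʳ q a p))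

⊛-congˡ : ∀ {p p′} q → p ≈ p′ → p ⊛ q ≈ p′ ⊛ q
⊛-congˡ {p} {p′} q e = ≈-trans (⊛-comm p q) (≈-trans (⊛-congʳ q e) (⊛-comm q p′))

⊛-cong : ∀ {p p′ q q′} → p ≈ p′ → q ≈ q′ → p ⊛ q ≈ p′ ⊛ q′
⊛-cong {p′ = p′} {q = q} e f = ≈-trans (⊛-congˡ q e) (⊛-congʳ p′ f)

⊛-distribʳ : ∀ p p′ q → (p ⊕ p′) ⊛ q ≈ (p ⊛ q) ⊕ (p′ ⊛ q)
⊛-distribʳ []      p′       q = ≈-refl
⊛-distribʳ (a ∷ p) []       q = ≈-sym (⊕-identityʳ _)
⊛-distribʳ (a ∷ p) (b ∷ p′) q = ≈-trans
  (⊕-cong (scale-distribʳ a b q) (∷-cong refl (⊛-distribʳ p p′ q)))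
  (⊕-interchange (scale a q) (scale b q) (+ 0 ∷ p ⊛ q) (+ 0 ∷ p′ ⊛ q))

⊛-distribˡ : ∀ p q q′ → p ⊛ (q ⊕ q′) ≈ (p ⊛ q) ⊕ (p ⊛ q′)
⊛-distribˡ p q q′ = ≈-trans (⊛-comm p (q ⊕ q′))
  (≈-trans (⊛-distribʳ q q′ p) (⊕-cong (⊛-comm q p) (⊛-comm q′ p)))

scale-⊛ : ∀ a p q → (scale a p) ⊛ q ≈ scale a (p ⊛ q)
scale-⊛ a []      q = ≈-refl
scale-⊛ a (b ∷ p) q = ≈-trans
  (⊕-cong (scale-* a b q) (∷-cong (sym (ℤP.*-zeroʳ a)) (scale-⊛ a p q)))
  (≈-sym (scale-distribˡ a (scale b q) (+ 0 ∷ p ⊛ q)))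

shift-⊛ : ∀ p q → (+ 0 ∷ p) ⊛ q ≈ + 0 ∷ p ⊛ q
shift-⊛ p q = ⊕-cong (scale-zero q) ≈-refl

⊛-assoc : ∀ p q r → (p ⊛ q) ⊛ r ≈ p ⊛ (q ⊛ r)
⊛-assoc []      q r = ≈-refl
⊛-assoc (a ∷ p) q r = ≈-trans (⊛-distribʳ (scale a q) (+ 0 ∷ p ⊛ q) r)
  (⊕-cong (scale-⊛ a q r) (≈-trans (shift-⊛ (p ⊛ q) r) (∷-cong refl (⊛-assoc p q r))))

one : Poly
one = + 1 ∷ []

⊛-identityˡ : ∀ p → one ⊛ p ≈ p
⊛-identityˡ p = coeffwise λ k → begin
  coeff (one ⊛ p) k                         ≡⟨ coeff-∷⊛ (+ 1) [] p k ⟩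
  + 1 ℤ.* coeff p k ℤ.+ coeff (+ 0 ∷ []) k  ≡⟨ cong₂ ℤ._+_ (ℤP.*-identityˡ (coeff p k)) (vanishes k) ⟩
  coeff p k ℤ.+ + 0                         ≡⟨ ℤP.+-identityʳ _ ⟩
  coeff p k                                 ∎
  where
  open ≡-Reasoning
  vanishes : ∀ k → coeff (+ 0 ∷ []) k ≡ + 0
  vanishes zero    = refl
  vanishes (suc k) = refl

⊛-identityʳ : ∀ p → p ⊛ one ≈ p
⊛-identityʳ p = ≈-trans (⊛-comm p one) (⊛-identityˡ p)

Poly-commutativeRing : CommutativeRing 0ℓ 0ℓ
Poly-commutativeRing = record
  { Carrier = Poly ; _≈_ = _≈_ ; _+_ = _⊕_ ; _*_ = _⊛_ ; -_ = negP ; 0# = [] ; 1# = one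
  ; isCommutativeRing = record
    { isRing = record
      { +-isAbelianGroup = record
        { isGroup = record
          { isMonoid = record
            { isSemigroup = record
              { isMagma = record
                { isEquivalence = record { refl = ≈-refl ; sym = ≈-sym ; trans = ≈-trans }
                ; ∙-cong = ⊕-cong }
              ; assoc = ⊕-assoc }
            ; identity = ⊕-identityˡ , ⊕-identityʳ }
          ; inverse = ⊕-inverseˡ , ⊕-inverseʳ
          ; ⁻¹-cong = negP-cong }
        ; comm = ⊕-comm }
      ; *-cong = ⊛-cong
      ; *-assoc = ⊛-assoc
      ; *-identity = ⊛-identityˡ , ⊛-identityʳ
      ; distrib = ⊛-distribˡ , λ p q r → ⊛-distribʳ q r p }
    ; *-comm = ⊛-comm } }

≈[]? : ∀ p → Maybe (p ≈ [])
≈[]? []          = just ≈-refl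
≈[]? (+ 0 ∷ p)   = Maybe.map 0∷-≈[] (≈[]? p)
≈[]? (_ ∷ _)     = nothing

module PolyReasoning = SetoidReasoning (CommutativeRing.setoid Poly-commutativeRing)

Poly-ring : AlmostCommutativeRing 0ℓ 0ℓ
Poly-ring = fromCommutativeRing Poly-commutativeRing λ p → Maybe.map ≈-sym (≈[]? p)

const : ℤ → Poly
const a = a ∷ []

const-⊛ : ∀ a p → const a ⊛ p ≈ scale a p
const-⊛ a p = ≈-trans (⊕-cong ≈-refl (0∷-≈[] ≈-refl)) (⊕-identityʳ (scale a p))

const-* : ∀ a b → const (a ℤ.* b) ≈ const a ⊛ const b
const-* a b = ≈-sym (const-⊛ a (const b))

const-pos-* : ∀ m n → const (+ (m * n)) ≈ const (+ m) ⊛ const (+ n)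
const-pos-* m n = ≈-trans (∷-cong (ℤP.pos-* m n) ≈-refl) (const-* (+ m) (+ n))

const-pos-lin : ∀ x a y b → const (+ (x * a + y * b)) ≈ (const (+ x) ⊛ const (+ a)) ⊕ (const (+ y) ⊛ const (+ b))
const-pos-lin x a y b =
  ≈-trans (∷-cong (ℤP.pos-+ (x * a) (y * b)) ≈-refl) (⊕-cong (const-pos-* x a) (const-pos-* y b))

mono-suc-⊛ : ∀ j p → mono (suc j) ⊛ p ≈ + 0 ∷ (mono j ⊛ p)
mono-suc-⊛ j p = shift-⊛ (mono j) p

mono-+ : ∀ a b → mono (a + b) ≈ mono a ⊛ mono b
mono-+ zero    b = ≈-sym (⊛-identityˡ (mono b))
mono-+ (suc a) b = ≈-trans (∷-cong refl (mono-+ a b)) (≈-sym (mono-suc-⊛ a (mono b)))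

mono-+-≡ : ∀ a b {c} → a + b ≡ c → mono a ⊛ mono b ≈ mono c
mono-+-≡ a b refl = ≈-sym (mono-+ a b)

mono-* : ∀ a t → mono (a * t) ≈ mono a ^ₚ t
mono-* a zero    rewrite ℕP.*-zeroʳ a = ≈-refl
mono-* a (suc t) rewrite ℕP.*-suc a t =
  ≈-trans (mono-+ a (a * t)) (⊛-congʳ (mono a) (mono-* a t))

geometricSum : Poly → ℕ → Poly
geometricSum w zero    = []
geometricSum w (suc k) = one ⊕ (w ⊛ geometricSum w k)

geometricSum-telescope : ∀ w k → (w ⊕ negP one) ⊛ geometricSum w k ≈ (w ^ₚ k) ⊕ negP one
geometricSum-telescope w zero    = ≈-trans (⊛-zeroʳ (w ⊕ negP one)) (≈-sym (⊕-inverseʳ one))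
geometricSum-telescope w (suc k) = begin
  (w ⊕ negP one) ⊛ (one ⊕ (w ⊛ G))          ≈⟨ expand w G ⟩
  (w ⊕ negP one) ⊕ (w ⊛ ((w ⊕ negP one) ⊛ G)) ≈⟨ ⊕-cong ≈-refl (⊛-congʳ w (geometricSum-telescope w k)) ⟩
  (w ⊕ negP one) ⊕ (w ⊛ ((w ^ₚ k) ⊕ negP one)) ≈⟨ collapse w (w ^ₚ k) ⟩
  (w ⊛ (w ^ₚ k)) ⊕ negP one                    ∎
  where
  open PolyReasoning
  G = geometricSum w k
  expand : ∀ w G → (w ⊕ negP one) ⊛ (one ⊕ (w ⊛ G)) ≈ (w ⊕ negP one) ⊕ (w ⊛ ((w ⊕ negP one) ⊛ G))
  expand = solve-∀ Poly-ring
  collapse : ∀ w W → (w ⊕ negP one) ⊕ (w ⊛ (W ⊕ negP one)) ≈ (w ⊛ W) ⊕ negP one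
  collapse = solve-∀ Poly-ring

geometricSums : Poly → ℕ → Poly
geometricSums w zero    = []
geometricSums w (suc k) = geometricSums w k ⊕ geometricSum w k

-- k − (1 + w + ⋯ + w^(k−1)) = Σ_{i<k} (1 − w^i), and 1 − w ∣ 1 − w^i.
const-minus-geometricSum : ∀ w k → const (+ k) ⊕ negP (geometricSum w k) ≈ (one ⊕ negP w) ⊛ geometricSums w k
const-minus-geometricSum w zero    = ≈-trans (0∷-≈[] ≈-refl) (≈-sym (⊛-zeroʳ (one ⊕ negP w)))
const-minus-geometricSum w (suc k) = begin
  (one ⊕ K) ⊕ negP (one ⊕ (w ⊛ G))                     ≈⟨ regroup K G w ⟩
  (K ⊕ negP G) ⊕ ((one ⊕ negP w) ⊛ G)                  ≈⟨ ⊕-cong (const-minus-geometricSum w k) ≈-refl ⟩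
  ((one ⊕ negP w) ⊛ V) ⊕ ((one ⊕ negP w) ⊛ G)          ≈⟨ ⊛-distribˡ (one ⊕ negP w) V G ⟨
  (one ⊕ negP w) ⊛ (V ⊕ G)                             ∎
  where
  open PolyReasoning
  K = const (+ k)
  G = geometricSum w k
  V = geometricSums w k
  regroup : ∀ K G w → (one ⊕ K) ⊕ negP (one ⊕ (w ⊛ G)) ≈ (K ⊕ negP G) ⊕ ((one ⊕ negP w) ⊛ G)
  regroup = solve-∀ Poly-ring

XdMinus1-* : ∀ d t → XdMinus1 (d * t) ≈ XdMinus1 d ⊛ geometricSum (mono d) t
XdMinus1-* d t = ≈-sym (≈-trans (geometricSum-telescope (mono d) t) (⊕-cong (≈-sym (mono-* d t)) ≈-refl))

-- With w = X^(dt): p − (1 + w + ⋯ + w^(p−1)) is a multiple of 1 − w = −(X^d − 1)(1 + X^d + ⋯ + X^(d(t−1))).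
const≈XdMinus1-multiple⊕geometricSum : ∀ d t p →
  const (+ p) ≈ (XdMinus1 d ⊛ negP (geometricSum (mono d) t ⊛ geometricSums (mono (d * t)) p))
                ⊕ geometricSum (mono (d * t)) p
const≈XdMinus1-multiple⊕geometricSum d t p = begin
  const (+ p)                                ≈⟨ split (const (+ p)) G ⟩
  (const (+ p) ⊕ negP G) ⊕ G                 ≈⟨ ⊕-cong (const-minus-geometricSum w p) ≈-refl ⟩
  ((one ⊕ negP w) ⊛ V) ⊕ G                   ≈⟨ ⊕-cong (⊛-congˡ V (flip w)) ≈-refl ⟩
  (negP (XdMinus1 (d * t)) ⊛ V) ⊕ G          ≈⟨ ⊕-cong (⊛-congˡ V (negP-cong (XdMinus1-* d t))) ≈-refl ⟩
  (negP (XdMinus1 d ⊛ H) ⊛ V) ⊕ G            ≈⟨ ⊕-cong (regroup (XdMinus1 d) H V) ≈-refl ⟩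
  (XdMinus1 d ⊛ negP (H ⊛ V)) ⊕ G            ∎
  where
  open PolyReasoning
  w = mono (d * t)
  G = geometricSum w p
  V = geometricSums w p
  H = geometricSum (mono d) t
  split : ∀ P G → P ≈ (P ⊕ negP G) ⊕ G
  split = solve-∀ Poly-ring
  flip : ∀ w → one ⊕ negP w ≈ negP (w ⊕ negP one)
  flip = solve-∀ Poly-ring
  regroup : ∀ X H V → negP (X ⊛ H) ⊛ V ≈ X ⊛ negP (H ⊛ V)
  regroup = solve-∀ Poly-ring

one-^ₚ : ∀ k → one ^ₚ k ≈ one
one-^ₚ zero    = ≈-refl
one-^ₚ (suc k) = ≈-trans (⊛-identityˡ (one ^ₚ k)) (one-^ₚ k)

^ₚ-distrib-⊛ : ∀ x y k → (x ⊛ y) ^ₚ k ≈ (x ^ₚ k) ⊛ (y ^ₚ k)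
^ₚ-distrib-⊛ x y zero    = ≈-sym (⊛-identityˡ one)
^ₚ-distrib-⊛ x y (suc k) = ≈-trans (⊛-congʳ (x ⊛ y) (^ₚ-distrib-⊛ x y k)) (interchange x y (x ^ₚ k) (y ^ₚ k))
  where
  interchange : ∀ x y X Y → (x ⊛ y) ⊛ (X ⊛ Y) ≈ (x ⊛ X) ⊛ (y ⊛ Y)
  interchange = solve-∀ Poly-ring

const-^ₚ : ∀ m k → const (+ (m ^ k)) ≈ const (+ m) ^ₚ k
const-^ₚ m zero    = ≈-refl
const-^ₚ m (suc k) = ≈-trans (≈-trans (∷-cong (ℤP.pos-* m (m ^ k)) ≈-refl) (const-* (+ m) (+ (m ^ k))))
                             (⊛-congʳ (const (+ m)) (const-^ₚ m k))

sumPoly : {A : Set} → (A → Poly) → List A → Poly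
sumPoly g = foldr (λ x P → g x ⊕ P) []

sumPoly-pairs : {A B : Set} (g : A → Poly) (a b : B → A) (l : List B) →
  sumPoly g (concatMap (λ v → a v ∷ b v ∷ []) l) ≈ sumPoly (λ v → g (a v) ⊕ g (b v)) l
sumPoly-pairs g a b []      = ≈-refl
sumPoly-pairs g a b (v ∷ l) =
  ≈-trans (⊕-cong (≈-refl {g (a v)}) (⊕-cong (≈-refl {g (b v)}) (sumPoly-pairs g a b l)))
          (≈-sym (⊕-assoc (g (a v)) (g (b v)) (sumPoly (λ v → g (a v) ⊕ g (b v)) l)))

sumPoly-⊛ : {A : Set} (c : Poly) (g : A → Poly) (l : List A) → sumPoly (λ x → c ⊛ g x) l ≈ c ⊛ sumPoly g l
sumPoly-⊛ c g []      = ≈-sym (⊛-zeroʳ c)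
sumPoly-⊛ c g (x ∷ l) = ≈-trans (⊕-cong ≈-refl (sumPoly-⊛ c g l)) (≈-sym (⊛-distribˡ c (g x) (sumPoly g l)))

prime∣prime^⇒≡ : ∀ {p′ p} → Prime p′ → Prime p → ∀ k → p′ ∣ p ^ k → p′ ≡ p
prime∣prime^⇒≡ p′-prime p-prime zero    p′∣1 = ⊥-elim (¬prime[1] (subst Prime (∣1⇒≡1 p′∣1) p′-prime))
prime∣prime^⇒≡ {p′} {p} p′-prime p-prime (suc k) p′∣p^k+1
  with euclidsLemma p (p ^ k) p′-prime p′∣p^k+1
... | inj₂ p′∣p^k = prime∣prime^⇒≡ p′-prime p-prime k p′∣p^k
... | inj₁ p′∣p with prime⇒irreducible p-prime p′∣p
...   | inj₁ p′≡1 = ⊥-elim (¬prime[1] (subst Prime p′≡1 p′-prime))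
...   | inj₂ p′≡p = p′≡p

prime-power-split : ∀ {p} → Prime p → ∀ N → .{{NonZero N}} → ∃₂ λ k u → N ≡ p ^ k * u × p ∤ u
prime-power-split {p} p-prime N = split N (<-wellFounded N)
  where
  split : ∀ N → Acc _<_ N → .{{NonZero N}} → ∃₂ λ k u → N ≡ p ^ k * u × p ∤ u
  split N (acc rec) {{N≢0}} with p ∣? N
  ... | no  p∤N = 0 , N , sym (ℕP.*-identityˡ N) , p∤N
  ... | yes (divides m N≡m*p) = extend (split m (rec m<N) {{m≢0}})
    where
    m≢0 : NonZero m
    m≢0 = ℕP.m*n≢0⇒m≢0 m {{subst NonZero N≡m*p N≢0}}
    m<N : m < N
    m<N = subst (m <_) (sym N≡m*p) (ℕP.m<m*n m p {{m≢0}} (nonTrivial⇒n>1 p {{prime⇒nonTrivial p-prime}}))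
    reassoc : ∀ p a u → a * u * p ≡ p * a * u
    reassoc = ℕ-Solver.solve-∀
    extend : (∃₂ λ k u → m ≡ p ^ k * u × p ∤ u) → ∃₂ λ k u → N ≡ p ^ k * u × p ∤ u
    extend (k , u , m≡p^k*u , p∤u) =
      suc k , u , trans N≡m*p (trans (cong (_* p) m≡p^k*u) (reassoc p (p ^ k) u)) , p∤u

-- Q is the exact power of p dividing N.
separating-prime-power : ∀ {N p e} → .{{NonZero N}} → Prime p → N ≡ e * p →
  ∃ λ Q → Q ∣ N × Q ∤ e ×
    (∀ {p′ e′} → Prime p′ → p′ ≢ p → N ≡ e′ * p′ → Q ∣ e′)
separating-prime-power {N} {p} {e} p-prime N≡e*p
  with prime-power-split p-prime N
... | k , u , N≡Q*u , p∤u = Q , divides u (trans N≡Q*u (ℕP.*-comm Q u)) , Q∤e , Q∣e′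
  where
  Q = p ^ k
  instance
    Q≢0 : NonZero Q
    Q≢0 = ℕP.m^n≢0 p k {{prime⇒nonZero p-prime}}
  Q∤e : Q ∤ e
  Q∤e (divides s e≡s*Q) = p∤u (divides s (ℕP.*-cancelˡ-≡ u (s * p) Q (begin
    Q * u       ≡⟨ N≡Q*u ⟨
    N           ≡⟨ N≡e*p ⟩
    e * p       ≡⟨ cong (_* p) e≡s*Q ⟩
    s * Q * p   ≡⟨ reassoc s Q p ⟩
    Q * (s * p) ∎)))
    where
    open ≡-Reasoning
    reassoc : ∀ s Q p → s * Q * p ≡ Q * (s * p)
    reassoc = ℕ-Solver.solve-∀
  Q∣e′ : ∀ {p′ e′} → Prime p′ → p′ ≢ p → N ≡ e′ * p′ → Q ∣ e′
  Q∣e′ {p′} {e′} p′-prime p′≢p N≡e′*p′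
    with euclidsLemma Q u p′-prime (divides e′ (trans (sym N≡Q*u) N≡e′*p′))
  ... | inj₁ p′∣Q = ⊥-elim (p′≢p (prime∣prime^⇒≡ p′-prime p-prime k p′∣Q))
  ... | inj₂ (divides t u≡t*p′) = divides t (ℕP.*-cancelʳ-≡ e′ (t * Q) p′ {{prime⇒nonZero p′-prime}} (begin
    e′ * p′       ≡⟨ N≡e′*p′ ⟨
    N             ≡⟨ N≡Q*u ⟩
    Q * u         ≡⟨ cong (Q *_) u≡t*p′ ⟩
    Q * (t * p′)  ≡⟨ reassoc Q t p′ ⟩
    t * Q * p′    ∎))
    where
    open ≡-Reasoning
    reassoc : ∀ Q t p′ → Q * (t * p′) ≡ t * Q * p′
    reassoc = ℕ-Solver.solve-∀

prime-factor : ∀ a .{{_ : NonZero a}} → a ≢ 1 → ∃₂ λ p t → Prime p × a ≡ p * t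
prime-factor a a≢1 with factorise a
... | record { factors = []     ; isFactorisation = a≡1 }                       = ⊥-elim (a≢1 a≡1)
... | record { factors = p ∷ ps ; isFactorisation = a≡p*Πps ; factorsPrime = p-prime ∷ _ } =
  p , product ps , p-prime , a≡p*Πps

-- Pell numbers

pell : ℕ → ℕ × ℕ
pell zero    = 1 , 0
pell (suc j) = let a , b = pell j in 3 * a + 4 * b , 2 * a + 3 * b

pell-norm : ∀ j → let a , b = pell j in a * a ≡ 2 * (b * b) + 1
pell-norm zero    = refl
pell-norm (suc j) = let a , b = pell j in begin
  (3 * a + 4 * b) * (3 * a + 4 * b)
    ≡⟨ expand a b ⟩
  a * a + (8 * (a * a) + 24 * (a * b) + 16 * (b * b))
    ≡⟨ cong (_+ (8 * (a * a) + 24 * (a * b) + 16 * (b * b))) (pell-norm j) ⟩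
  2 * (b * b) + 1 + (8 * (a * a) + 24 * (a * b) + 16 * (b * b))
    ≡⟨ collect a b ⟩
  2 * ((2 * a + 3 * b) * (2 * a + 3 * b)) + 1 ∎
  where
  open ≡-Reasoning
  expand : ∀ a b → (3 * a + 4 * b) * (3 * a + 4 * b) ≡ a * a + (8 * (a * a) + 24 * (a * b) + 16 * (b * b))
  expand = ℕ-Solver.solve-∀
  collect : ∀ a b → 2 * (b * b) + 1 + (8 * (a * a) + 24 * (a * b) + 16 * (b * b)) ≡
                    2 * ((2 * a + 3 * b) * (2 * a + 3 * b)) + 1
  collect = ℕ-Solver.solve-∀

pell-fst-positive : ∀ j → 1 ≤ proj₁ (pell j)
pell-fst-positive zero    = ℕP.≤-refl
pell-fst-positive (suc j) = ℕP.≤-trans (pell-fst-positive j)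
  (ℕP.≤-trans (ℕP.m≤n*m (proj₁ (pell j)) 3) (ℕP.m≤m+n (3 * proj₁ (pell j)) (4 * proj₂ (pell j))))

pell-fst-suc≢1 : ∀ j → proj₁ (pell (suc j)) ≢ 1
pell-fst-suc≢1 j a≡1 = ℕP.<-irrefl (sym a≡1) (begin-strict
  1                                          <⟨ s≤s (s≤s z≤n) ⟩
  3 * 1                                      ≤⟨ ℕP.*-monoʳ-≤ 3 (pell-fst-positive j) ⟩
  3 * proj₁ (pell j)                         ≤⟨ ℕP.m≤m+n (3 * proj₁ (pell j)) (4 * proj₂ (pell j)) ⟩
  proj₁ (pell (suc j))                       ∎)
  where open ℕP.≤-Reasoning

pell-defect : ℕ → ℤ
pell-defect j = let a , b = pell j in (+ a ℤ.- + 1) ℤ.* (+ a ℤ.- + 1) ℤ.- + 2 ℤ.* (+ b ℤ.* + b)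

pell-defect≡2-2a : ∀ j → pell-defect j ≡ + 2 ℤ.- + 2 ℤ.* + proj₁ (pell j)
pell-defect≡2-2a j = begin
  (α ℤ.- + 1) ℤ.* (α ℤ.- + 1) ℤ.- + 2 ℤ.* (β ℤ.* β)   ≡⟨ expand α β ⟩
  (α ℤ.* α ℤ.- x) ℤ.+ (+ 2 ℤ.- + 2 ℤ.* α)            ≡⟨ cong (λ y → (y ℤ.- x) ℤ.+ (+ 2 ℤ.- + 2 ℤ.* α)) norm ⟩
  (x ℤ.- x) ℤ.+ (+ 2 ℤ.- + 2 ℤ.* α)                  ≡⟨ cancel x (+ 2 ℤ.- + 2 ℤ.* α) ⟩
  + 2 ℤ.- + 2 ℤ.* α                                   ∎
  where
  open ≡-Reasoning
  a = proj₁ (pell j)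
  b = proj₂ (pell j)
  α = + a
  β = + b
  x = + 2 ℤ.* (β ℤ.* β) ℤ.+ + 1
  norm : α ℤ.* α ≡ x
  norm = begin
    α ℤ.* α                    ≡⟨ ℤP.pos-* a a ⟨
    + (a * a)                  ≡⟨ cong +_ (pell-norm j) ⟩
    + (2 * (b * b) + 1)        ≡⟨ ℤP.pos-+ (2 * (b * b)) 1 ⟩
    + (2 * (b * b)) ℤ.+ + 1    ≡⟨ cong (ℤ._+ + 1) (trans (ℤP.pos-* 2 (b * b)) (cong (+ 2 ℤ.*_) (ℤP.pos-* b b))) ⟩
    x                          ∎
  expand : ∀ α β → (α ℤ.- + 1) ℤ.* (α ℤ.- + 1) ℤ.- + 2 ℤ.* (β ℤ.* β) ≡
                   (α ℤ.* α ℤ.- (+ 2 ℤ.* (β ℤ.* β) ℤ.+ + 1)) ℤ.+ (+ 2 ℤ.- + 2 ℤ.* α)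
  expand = ℤ-Solver.solve-∀
  cancel : ∀ x y → (x ℤ.- x) ℤ.+ y ≡ y
  cancel = ℤ-Solver.solve-∀

pell-defect-suc≢0 : ∀ k → pell-defect (suc k) ≢ + 0
pell-defect-suc≢0 k defect≡0 = pell-fst-suc≢1 k (sym (ℤP.+-injective (ℤP.*-cancelˡ-≡ (+ 2) (+ 1) α
  (ℤP.i-j≡0⇒i≡j (+ 2) (+ 2 ℤ.* α) (trans (sym (pell-defect≡2-2a (suc k))) defect≡0)))))
  where α = + proj₁ (pell (suc k))

-- Polynomials vanishing at a primitive N-th root of unity

module Cyclotomic (N : ℕ) {{N≢0 : NonZero N}} where

  primeCofactors : ℕ → List (ℕ × ℕ)
  primeCofactors zero = []
  primeCofactors (suc k) with prime? (suc k) | suc k ∣? N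
  ... | yes _ | yes (divides e _) = (suc k , e) ∷ primeCofactors k
  ... | yes _ | no  _             = primeCofactors k
  ... | no  _ | _                 = primeCofactors k

  record IsPrimeCofactor (k p e : ℕ) : Set where
    constructor isPrimeCofactor
    field
      prime : Prime p
      cofactor : N ≡ e * p
      bounded : p ≤ k

  private
    IsPrimeCofactor-suc : ∀ {k p e} → IsPrimeCofactor k p e → IsPrimeCofactor (suc k) p e
    IsPrimeCofactor-suc (isPrimeCofactor p-prime N≡e*p p≤k) = isPrimeCofactor p-prime N≡e*p (ℕP.m≤n⇒m≤1+n p≤k)

  primeCofactors-sound : ∀ k {p e} → (p , e) ∈ primeCofactors k → IsPrimeCofactor k p e
  primeCofactors-sound (suc k) pe∈ with prime? (suc k) | suc k ∣? N
  primeCofactors-sound (suc k) (here refl) | yes p-prime | yes (divides e N≡e*p) = isPrimeCofactor p-prime N≡e*p ℕP.≤-refl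
  primeCofactors-sound (suc k) (there pe∈) | yes _ | yes _ = IsPrimeCofactor-suc (primeCofactors-sound k pe∈)
  primeCofactors-sound (suc k) pe∈         | yes _ | no  _ = IsPrimeCofactor-suc (primeCofactors-sound k pe∈)
  primeCofactors-sound (suc k) pe∈         | no  _ | _     = IsPrimeCofactor-suc (primeCofactors-sound k pe∈)

  primeCofactors-complete : ∀ k {p} → Prime p → p ∣ N → p ≤ k → ∃ λ e → (p , e) ∈ primeCofactors k
  primeCofactors-complete zero    p-prime p∣N z≤n = ⊥-elim (¬prime[0] p-prime)
  primeCofactors-complete (suc k) {p} p-prime p∣N p≤k with ℕP.m≤n⇒m<n∨m≡n p≤k
  primeCofactors-complete (suc k) {p} p-prime p∣N p≤k | inj₁ (s≤s p≤k′) with prime? (suc k) | suc k ∣? N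
  ... | yes _ | yes _ = let e , pe∈ = primeCofactors-complete k p-prime p∣N p≤k′ in e , there pe∈
  ... | yes _ | no  _ = primeCofactors-complete k p-prime p∣N p≤k′
  ... | no  _ | _     = primeCofactors-complete k p-prime p∣N p≤k′
  primeCofactors-complete (suc k) {p} p-prime p∣N p≤k | inj₂ refl with prime? (suc k) | suc k ∣? N
  ... | yes _ | yes _        = _ , here refl
  ... | yes _ | no  p∤N      = ⊥-elim (p∤N p∣N)
  ... | no  ¬p-prime | _     = ⊥-elim (¬p-prime p-prime)

  δ : ℕ → ℤ
  δ r = if does (N ∣? r) then + 1 else + 0

  -- residueSum r p sums the coefficients pₖ with N ∣ r + k: it is the constant term of X^r p mod X^N − 1.
  residueSum : ℕ → Poly → ℤ
  residueSum r []      = + 0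
  residueSum r (a ∷ p) = δ r ℤ.* a ℤ.+ residueSum (suc r) p

  δ-∣ : ∀ {r} → N ∣ r → δ r ≡ + 1
  δ-∣ {r} N∣r with N ∣? r
  ... | yes _   = refl
  ... | no  N∤r = ⊥-elim (N∤r N∣r)

  δ-∤ : ∀ {r} → N ∤ r → δ r ≡ + 0
  δ-∤ {r} N∤r with N ∣? r
  ... | yes N∣r = ⊥-elim (N∤r N∣r)
  ... | no  _   = refl

  δ-periodic : ∀ r → δ (r + N) ≡ δ r
  δ-periodic r with N ∣? r
  ... | yes N∣r = δ-∣ (∣m∣n⇒∣m+n N∣r ∣-refl)
  ... | no  N∤r = δ-∤ λ N∣r+N → N∤r (∣m+n∣m⇒∣n (subst (N ∣_) (ℕP.+-comm r N) N∣r+N) ∣-refl)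

  residueSum-⊕ : ∀ r p q → residueSum r (p ⊕ q) ≡ residueSum r p ℤ.+ residueSum r q
  residueSum-⊕ r []      q       = sym (ℤP.+-identityˡ _)
  residueSum-⊕ r (a ∷ p) []      = sym (ℤP.+-identityʳ _)
  residueSum-⊕ r (a ∷ p) (b ∷ q) =
    trans (cong (ℤ._+_ (δ r ℤ.* (a ℤ.+ b))) (residueSum-⊕ (suc r) p q)) (regroup (δ r) a b _ _)
    where
    regroup : ∀ d a b x y → d ℤ.* (a ℤ.+ b) ℤ.+ (x ℤ.+ y) ≡ (d ℤ.* a ℤ.+ x) ℤ.+ (d ℤ.* b ℤ.+ y)
    regroup = ℤ-Solver.solve-∀

  residueSum-negP : ∀ r p → residueSum r (negP p) ≡ - residueSum r p
  residueSum-negP r []      = refl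
  residueSum-negP r (a ∷ p) =
    trans (cong (ℤ._+_ (δ r ℤ.* - a)) (residueSum-negP (suc r) p)) (regroup (δ r) a _)
    where
    regroup : ∀ d a x → d ℤ.* - a ℤ.+ - x ≡ - (d ℤ.* a ℤ.+ x)
    regroup = ℤ-Solver.solve-∀

  residueSum-scale : ∀ r c p → residueSum r (scale c p) ≡ c ℤ.* residueSum r p
  residueSum-scale r c []      = sym (ℤP.*-zeroʳ c)
  residueSum-scale r c (a ∷ p) =
    trans (cong (ℤ._+_ (δ r ℤ.* (c ℤ.* a))) (residueSum-scale (suc r) c p)) (regroup (δ r) c a _)
    where
    regroup : ∀ d c a x → d ℤ.* (c ℤ.* a) ℤ.+ c ℤ.* x ≡ c ℤ.* (d ℤ.* a ℤ.+ x)
    regroup = ℤ-Solver.solve-∀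

  residueSum-≈[] : ∀ r {p} → p ≈ [] → residueSum r p ≡ + 0
  residueSum-≈[] r {[]}    p≈[] = refl
  residueSum-≈[] r {a ∷ p} p≈[] =
    cong₂ ℤ._+_ (trans (cong (δ r ℤ.*_) (coeff-≡ p≈[] 0)) (ℤP.*-zeroʳ (δ r)))
                (residueSum-≈[] (suc r) {p} (coeffwise λ k → coeff-≡ p≈[] (suc k)))

  residueSum-cong : ∀ r {p q} → p ≈ q → residueSum r p ≡ residueSum r q
  residueSum-cong r {p} {q} p≈q = ℤP.i-j≡0⇒i≡j (residueSum r p) (residueSum r q) (begin
    residueSum r p ℤ.- residueSum r q          ≡⟨ cong (ℤ._+_ (residueSum r p)) (residueSum-negP r q) ⟨
    residueSum r p ℤ.+ residueSum r (negP q)   ≡⟨ residueSum-⊕ r p (negP q) ⟨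
    residueSum r (p ⊕ negP q)                  ≡⟨ residueSum-≈[] r (≈-trans (⊕-cong p≈q ≈-refl) (⊕-inverseʳ q)) ⟩
    + 0                                        ∎)
    where open ≡-Reasoning

  residueSum-mono-⊛ : ∀ j r p → residueSum r (mono j ⊛ p) ≡ residueSum (r + j) p
  residueSum-mono-⊛ zero    r p = trans (residueSum-cong r (⊛-identityˡ p)) (cong (λ s → residueSum s p) (sym (ℕP.+-identityʳ r)))
  residueSum-mono-⊛ (suc j) r p = begin
    residueSum r (mono (suc j) ⊛ p)            ≡⟨ residueSum-cong r (mono-suc-⊛ j p) ⟩
    δ r ℤ.* + 0 ℤ.+ residueSum (suc r) (mono j ⊛ p)
                                               ≡⟨ cong₂ ℤ._+_ (ℤP.*-zeroʳ (δ r)) (residueSum-mono-⊛ j (suc r) p) ⟩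
    + 0 ℤ.+ residueSum (suc r + j) p           ≡⟨ ℤP.+-identityˡ _ ⟩
    residueSum (suc r + j) p                   ≡⟨ cong (λ s → residueSum s p) (ℕP.+-suc r j) ⟨
    residueSum (r + suc j) p                   ∎
    where open ≡-Reasoning

  residueSum-periodic : ∀ r p → residueSum (r + N) p ≡ residueSum r p
  residueSum-periodic r []      = refl
  residueSum-periodic r (a ∷ p) = cong₂ ℤ._+_ (cong (ℤ._* a) (δ-periodic r)) (residueSum-periodic (suc r) p)

  residueSum-[X^N-1]-multiple : ∀ r h → residueSum r (h ⊛ XdMinus1 N) ≡ + 0
  residueSum-[X^N-1]-multiple r h = begin
    residueSum r (h ⊛ XdMinus1 N)                      ≡⟨ residueSum-cong r (expand h (mono N)) ⟩
    residueSum r ((mono N ⊛ h) ⊕ negP h)               ≡⟨ residueSum-⊕ r (mono N ⊛ h) (negP h) ⟩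
    residueSum r (mono N ⊛ h) ℤ.+ residueSum r (negP h) ≡⟨ cong₂ ℤ._+_ (residueSum-mono-⊛ N r h) (residueSum-negP r h) ⟩
    residueSum (r + N) h ℤ.- residueSum r h            ≡⟨ cong (ℤ._- residueSum r h) (residueSum-periodic r h) ⟩
    residueSum r h ℤ.- residueSum r h                  ≡⟨ ℤP.+-inverseʳ (residueSum r h) ⟩
    + 0                                                ∎
    where
    open ≡-Reasoning
    expand : ∀ h X → h ⊛ (X ⊕ negP one) ≈ (X ⊛ h) ⊕ negP h
    expand = solve-∀ Poly-ring

  residueSum-[1-X^e]-⊛ : ∀ e r p → residueSum r ((one ⊕ negP (mono e)) ⊛ p) ≡ residueSum r p ℤ.- residueSum (r + e) p
  residueSum-[1-X^e]-⊛ e r p = begin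
    residueSum r ((one ⊕ negP (mono e)) ⊛ p)              ≡⟨ residueSum-cong r (expand (mono e) p) ⟩
    residueSum r (p ⊕ negP (mono e ⊛ p))                  ≡⟨ residueSum-⊕ r p _ ⟩
    residueSum r p ℤ.+ residueSum r (negP (mono e ⊛ p))   ≡⟨ cong (ℤ._+_ (residueSum r p)) (residueSum-negP r (mono e ⊛ p)) ⟩
    residueSum r p ℤ.- residueSum r (mono e ⊛ p)          ≡⟨ cong (λ s → residueSum r p ℤ.- s) (residueSum-mono-⊛ e r p) ⟩
    residueSum r p ℤ.- residueSum (r + e) p               ∎
    where
    open ≡-Reasoning
    expand : ∀ X p → (one ⊕ negP X) ⊛ p ≈ p ⊕ negP (X ⊛ p)
    expand = solve-∀ Poly-ring

  εOf : List (ℕ × ℕ) → Poly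
  εOf = foldr (λ pe P → (one ⊕ negP (mono (proj₂ pe))) ⊛ P) one

  ε : Poly
  ε = εOf (primeCofactors N)

  -- All exponents of εOf l are multiples of Q, so X^r εOf l has no exponent divisible by N.
  residueSum-εOf-vanishes : ∀ {Q} → Q ∣ N → ∀ l → (∀ {p e} → (p , e) ∈ l → Q ∣ e) →
                            ∀ r → Q ∤ r → residueSum r (εOf l) ≡ + 0
  residueSum-εOf-vanishes Q∣N [] Q∣es r Q∤r =
    cong (λ d → d ℤ.* + 1 ℤ.+ + 0) (δ-∤ λ N∣r → Q∤r (∣-trans Q∣N N∣r))
  residueSum-εOf-vanishes {Q} Q∣N ((p , e) ∷ l) Q∣es r Q∤r = begin
    residueSum r ((one ⊕ negP (mono e)) ⊛ εOf l)          ≡⟨ residueSum-[1-X^e]-⊛ e r (εOf l) ⟩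
    residueSum r (εOf l) ℤ.- residueSum (r + e) (εOf l)   ≡⟨ cong₂ ℤ._-_ (vanishes r Q∤r) (vanishes (r + e) Q∤r+e) ⟩
    + 0                                                   ∎
    where
    open ≡-Reasoning
    vanishes = residueSum-εOf-vanishes Q∣N l (λ pe∈l → Q∣es (there pe∈l))
    Q∤r+e : Q ∤ r + e
    Q∤r+e Q∣r+e = Q∤r (∣m+n∣m⇒∣n (subst (Q ∣_) (ℕP.+-comm r e) Q∣r+e) (Q∣es (here refl)))

  residueSum-εOf-primeCofactors : ∀ k → residueSum 0 (εOf (primeCofactors k)) ≡ + 1
  residueSum-εOf-primeCofactors zero = cong (λ d → d ℤ.* + 1 ℤ.+ + 0) (δ-∣ (divides 0 refl))
  residueSum-εOf-primeCofactors (suc k) with prime? (suc k) | suc k ∣? N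
  ... | yes p-prime | yes (divides e N≡e*p) = begin
    residueSum 0 ((one ⊕ negP (mono e)) ⊛ εOf (primeCofactors k))
      ≡⟨ residueSum-[1-X^e]-⊛ e 0 _ ⟩
    residueSum 0 (εOf (primeCofactors k)) ℤ.- residueSum e (εOf (primeCofactors k))
      ≡⟨ cong₂ ℤ._-_ (residueSum-εOf-primeCofactors k) N/p-vanishes ⟩
    + 1 ℤ.- + 0 ∎
    where
    open ≡-Reasoning
    N/p-vanishes : residueSum e (εOf (primeCofactors k)) ≡ + 0
    N/p-vanishes with separating-prime-power p-prime N≡e*p
    ... | Q , Q∣N , Q∤e , Q∣e′ = residueSum-εOf-vanishes Q∣N (primeCofactors k) Q∣cofactor e Q∤e
      where
      Q∣cofactor : ∀ {p′ e′} → (p′ , e′) ∈ primeCofactors k → Q ∣ e′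
      Q∣cofactor p′e′∈ with primeCofactors-sound k p′e′∈
      ... | isPrimeCofactor p′-prime N≡e′*p′ p′≤k = Q∣e′ p′-prime (λ { refl → ℕP.<-irrefl refl p′≤k }) N≡e′*p′
  ... | yes _ | no  _ = residueSum-εOf-primeCofactors k
  ... | no  _ | _     = residueSum-εOf-primeCofactors k

  residueSum-ε : residueSum 0 ε ≡ + 1
  residueSum-ε = residueSum-εOf-primeCofactors N

  -- Kerζ P encodes P(ζ) = 0 for a primitive N-th root of unity ζ: X^N − 1 is squarefree and
  -- ε = ∏_{p ∣ N} (1 − X^(N/p)) vanishes exactly at its non-primitive roots, so X^N − 1 ∣ ε P iff P
  -- vanishes at all primitive N-th roots of unity.  The nonzero scalar makes the ideal saturated.
  record Kerζ (P : Poly) : Set where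
    constructor kerζ
    field
      scalar       : ℕ
      {{scalar≢0}} : NonZero scalar
      cofactor     : Poly
      divisible    : ε ⊛ (const (+ scalar) ⊛ P) ≈ cofactor ⊛ XdMinus1 N

  Kerζ-isIdeal : IsIdeal Poly-commutativeRing Kerζ
  Kerζ-isIdeal = record
    { ∈-resp    = λ P≈Q (kerζ c h εcP≈hX) →
                    kerζ c h (≈-trans (⊛-congʳ ε (⊛-congʳ (const (+ c)) (≈-sym P≈Q))) εcP≈hX)
    ; 0∈        = kerζ 1 [] (≈-trans (⊛-congʳ ε (⊛-zeroʳ one)) (⊛-zeroʳ ε))
    ; +-closed  = +-closed
    ; *-closedˡ = *-closedˡ
    }
    where
    open PolyReasoning
    +-closed : ∀ {P Q} → Kerζ P → Kerζ Q → Kerζ (P ⊕ Q)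
    +-closed {P} {Q} (kerζ a g εaP≈gX) (kerζ b h εbQ≈hX) =
      kerζ (a * b) {{ℕP.m*n≢0 a b}} ((B ⊛ g) ⊕ (A ⊛ h)) (begin
        ε ⊛ (const (+ (a * b)) ⊛ (P ⊕ Q))     ≈⟨ ⊛-congʳ ε (⊛-congˡ (P ⊕ Q) (const-pos-* a b)) ⟩
        ε ⊛ ((A ⊛ B) ⊛ (P ⊕ Q))               ≈⟨ split ε A B P Q ⟩
        (B ⊛ (ε ⊛ (A ⊛ P))) ⊕ (A ⊛ (ε ⊛ (B ⊛ Q))) ≈⟨ ⊕-cong (⊛-congʳ B εaP≈gX) (⊛-congʳ A εbQ≈hX) ⟩
        (B ⊛ (g ⊛ X)) ⊕ (A ⊛ (h ⊛ X))         ≈⟨ merge A B g h X ⟩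
        ((B ⊛ g) ⊕ (A ⊛ h)) ⊛ X               ∎)
      where
      A = const (+ a)
      B = const (+ b)
      X = XdMinus1 N
      split : ∀ ε A B P Q → ε ⊛ ((A ⊛ B) ⊛ (P ⊕ Q)) ≈ (B ⊛ (ε ⊛ (A ⊛ P))) ⊕ (A ⊛ (ε ⊛ (B ⊛ Q)))
      split = solve-∀ Poly-ring
      merge : ∀ A B g h X → (B ⊛ (g ⊛ X)) ⊕ (A ⊛ (h ⊛ X)) ≈ ((B ⊛ g) ⊕ (A ⊛ h)) ⊛ X
      merge = solve-∀ Poly-ring
    *-closedˡ : ∀ R {P} → Kerζ P → Kerζ (R ⊛ P)
    *-closedˡ R {P} (kerζ c h εcP≈hX) = kerζ c (R ⊛ h) (begin
      ε ⊛ (const (+ c) ⊛ (R ⊛ P))  ≈⟨ pull ε (const (+ c)) R P ⟩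
      R ⊛ (ε ⊛ (const (+ c) ⊛ P))  ≈⟨ ⊛-congʳ R εcP≈hX ⟩
      R ⊛ (h ⊛ XdMinus1 N)         ≈⟨ ⊛-assoc R h (XdMinus1 N) ⟨
      (R ⊛ h) ⊛ XdMinus1 N         ∎)
      where
      pull : ∀ ε C R P → ε ⊛ (C ⊛ (R ⊛ P)) ≈ R ⊛ (ε ⊛ (C ⊛ P))
      pull = solve-∀ Poly-ring

  open IsIdeal Kerζ-isIdeal public
    using () renaming (∈-resp to Kerζ-resp; +-closed to Kerζ-+-closed; *-closedˡ to Kerζ-*-closedˡ)

  open Quotient Poly-commutativeRing Kerζ-isIdeal public
    using (_≋_; mk≋; difference∈; ≈⇒≋; ≋-refl; ≋-sym; ≋-trans; +-cong-≋; *-cong-≋; *-congˡ-≋; *-congʳ-≋; -‿cong-≋;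
           module ≋-Reasoning)

  Kerζ⇒≋0 : ∀ {P} → Kerζ P → P ≋ []
  Kerζ⇒≋0 {P} = mk≋ ∘ Kerζ-resp (≈-sym (⊕-identityʳ P))

  ≋0⇒Kerζ : ∀ {P} → P ≋ [] → Kerζ P
  ≋0⇒Kerζ {P} = Kerζ-resp (⊕-identityʳ P) ∘ difference∈

  Kerζ-saturated : ∀ m .{{_ : NonZero m}} {P} → Kerζ (const (+ m) ⊛ P) → Kerζ P
  Kerζ-saturated m {P} (kerζ c h εcmP≈hX) = kerζ (c * m) {{ℕP.m*n≢0 c m}} h
    (≈-trans (⊛-congʳ ε (≈-trans (⊛-congˡ P (const-pos-* c m)) (⊛-assoc (const (+ c)) (const (+ m)) P))) εcmP≈hX)

  -- The residue sum at 0 is 1 on ε but 0 on multiples of X^N − 1.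
  const∉Kerζ : ∀ {z} → z ≢ + 0 → ¬ Kerζ (const z)
  const∉Kerζ {z} z≢0 (kerζ c {{c≢0}} h εcz≈hX) = z≢0 (ℤP.*-cancelˡ-≡ (+ c) z (+ 0) {{c≢0}} (begin
    + c ℤ.* z                                ≡⟨ ℤP.*-identityʳ (+ c ℤ.* z) ⟨
    + c ℤ.* z ℤ.* + 1                        ≡⟨ cong (+ c ℤ.* z ℤ.*_) residueSum-ε ⟨
    + c ℤ.* z ℤ.* residueSum 0 ε             ≡⟨ residueSum-scale 0 (+ c ℤ.* z) ε ⟨
    residueSum 0 (scale (+ c ℤ.* z) ε)        ≡⟨ residueSum-cong 0 εcz≈scale ⟨
    residueSum 0 (ε ⊛ (const (+ c) ⊛ const z)) ≡⟨ residueSum-cong 0 εcz≈hX ⟩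
    residueSum 0 (h ⊛ XdMinus1 N)            ≡⟨ residueSum-[X^N-1]-multiple 0 h ⟩
    + 0                                      ≡⟨ ℤP.*-zeroʳ (+ c) ⟨
    + c ℤ.* + 0                              ∎))
    where
    open ≡-Reasoning
    εcz≈scale : ε ⊛ (const (+ c) ⊛ const z) ≈ scale (+ c ℤ.* z) ε
    εcz≈scale = ≈-trans (⊛-congʳ ε (≈-sym (const-* (+ c) z)))
                        (≈-trans (⊛-comm ε (const (+ c ℤ.* z))) (const-⊛ (+ c ℤ.* z) ε))

  X^N≋1 : mono N ≋ one
  X^N≋1 = mk≋ (kerζ 1 ε (⊛-congʳ ε (⊛-identityˡ (XdMinus1 N))))

  ≈-mod-Kerζ : ∀ {x y d} z → Kerζ d → x ≈ y ⊕ (z ⊛ d) → x ≋ y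
  ≈-mod-Kerζ {x} {y} {d} z d∈ x≈y+zd = mk≋ (Kerζ-resp (≈-sym x-y≈zd) (Kerζ-*-closedˡ z d∈))
    where
    cancel : ∀ y z → (y ⊕ z) ⊕ negP y ≈ z
    cancel = solve-∀ Poly-ring
    x-y≈zd : x ⊕ negP y ≈ z ⊛ d
    x-y≈zd = ≈-trans (⊕-cong x≈y+zd ≈-refl) (cancel y (z ⊛ d))

  ^ₚ-cong-≋ : ∀ {x y} k → x ≋ y → x ^ₚ k ≋ y ^ₚ k
  ^ₚ-cong-≋ zero    x≋y = ≋-refl
  ^ₚ-cong-≋ (suc k) x≋y = *-cong-≋ x≋y (^ₚ-cong-≋ k x≋y)

  ≋1⇒^ₚ≋1 : ∀ {x} k → x ≋ one → x ^ₚ k ≋ one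
  ≋1⇒^ₚ≋1 k x≋1 = ≋-trans (^ₚ-cong-≋ k x≋1) (≈⇒≋ (one-^ₚ k))

  sumPoly-cong-≋ : {A : Set} {g h : A → Poly} (l : List A) → (∀ x → g x ≋ h x) → sumPoly g l ≋ sumPoly h l
  sumPoly-cong-≋ []      g≋h = ≋-refl
  sumPoly-cong-≋ (x ∷ l) g≋h = +-cong-≋ (g≋h x) (sumPoly-cong-≋ l g≋h)

  cancel-unit : ∀ a b x → a ⊛ b ≋ one → a ⊛ x ≋ [] → x ≋ []
  cancel-unit a b x ab≋1 ax≋0 = begin
    x               ≈⟨ ≈⇒≋ (⊛-identityˡ x) ⟨
    one ⊛ x         ≈⟨ *-congʳ-≋ x ab≋1 ⟨
    (a ⊛ b) ⊛ x     ≈⟨ ≈⇒≋ (rearrange a b x) ⟩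
    b ⊛ (a ⊛ x)     ≈⟨ *-congˡ-≋ b ax≋0 ⟩
    b ⊛ []          ≈⟨ ≈⇒≋ (⊛-zeroʳ b) ⟩
    []              ∎
    where
    open ≋-Reasoning
    rearrange : ∀ a b x → (a ⊛ b) ⊛ x ≈ b ⊛ (a ⊛ x)
    rearrange = solve-∀ Poly-ring

  εOf-factor : ∀ l {p e} → (p , e) ∈ l → ∃ λ rest → εOf l ≈ (one ⊕ negP (mono e)) ⊛ rest
  εOf-factor ((p , e) ∷ l) (here refl) = εOf l , ≈-refl
  εOf-factor ((p′ , e′) ∷ l) {e = e} (there pe∈l) with εOf-factor l pe∈l
  ... | rest , εl≈ = (one ⊕ negP (mono e′)) ⊛ rest ,
    ≈-trans (⊛-congʳ (one ⊕ negP (mono e′)) εl≈) (swap (one ⊕ negP (mono e′)) (one ⊕ negP (mono e)) rest)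
    where
    swap : ∀ a b r → a ⊛ (b ⊛ r) ≈ b ⊛ (a ⊛ r)
    swap = solve-∀ Poly-ring

  -- With w = X^(N/p): (1 − w)(1 + w + ⋯ + w^(p−1)) = 1 − X^N, and 1 − w divides ε.
  Kerζ-geometricSum : ∀ {p e} → Prime p → N ≡ e * p → Kerζ (geometricSum (mono e) p)
  Kerζ-geometricSum {p} {e} p-prime N≡e*p with εOf-factor (primeCofactors N) pe∈
    where
    p∣N = divides e N≡e*p
    e′ = proj₁ (primeCofactors-complete N p-prime p∣N (∣⇒≤ p∣N))
    pe′∈ = proj₂ (primeCofactors-complete N p-prime p∣N (∣⇒≤ p∣N))
    e′≡e : e′ ≡ e
    e′≡e = ℕP.*-cancelʳ-≡ e′ e p {{prime⇒nonZero p-prime}}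
             (trans (sym (IsPrimeCofactor.cofactor (primeCofactors-sound N pe′∈))) N≡e*p)
    pe∈ : (p , e) ∈ primeCofactors N
    pe∈ = subst (λ e → (p , e) ∈ primeCofactors N) e′≡e pe′∈
  ... | rest , ε≈[1-w]rest = kerζ 1 (negP rest) (begin
    ε ⊛ (one ⊛ G)                           ≈⟨ ⊛-cong ε≈[1-w]rest (⊛-identityˡ G) ⟩
    ((one ⊕ negP w) ⊛ rest) ⊛ G             ≈⟨ rearrange w rest G ⟩
    negP rest ⊛ ((w ⊕ negP one) ⊛ G)        ≈⟨ ⊛-congʳ (negP rest) (geometricSum-telescope w p) ⟩
    negP rest ⊛ ((w ^ₚ p) ⊕ negP one)       ≈⟨ ⊛-congʳ (negP rest) (⊕-cong (mono-* e p) ≈-refl) ⟨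
    negP rest ⊛ XdMinus1 (e * p)            ≡⟨ cong (λ m → negP rest ⊛ XdMinus1 m) N≡e*p ⟨
    negP rest ⊛ XdMinus1 N                  ∎)
    where
    open PolyReasoning
    w = mono e
    G = geometricSum w p
    rearrange : ∀ w r G → ((one ⊕ negP w) ⊛ r) ⊛ G ≈ negP r ⊛ ((w ⊕ negP one) ⊛ G)
    rearrange = solve-∀ Poly-ring

  -- For a prime p ∣ N/d, p R is a combination of R (X^d − 1) and 1 + w + ⋯ + w^(p−1) with w = X^(N/p).
  Kerζ-cancel-XdMinus1 : ∀ {d R} → d ∣ N → d ≢ N → Kerζ (R ⊛ XdMinus1 d) → Kerζ R
  Kerζ-cancel-XdMinus1 {d} {R} (divides a N≡a*d) d≢N R[X^d-1]∈ with prime-factor a {{a≢0}} a≢1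
    where
    a≢0 : NonZero a
    a≢0 = ℕP.m*n≢0⇒m≢0 a {{subst NonZero N≡a*d N≢0}}
    a≢1 : a ≢ 1
    a≢1 refl = d≢N (sym (trans N≡a*d (ℕP.*-identityˡ d)))
  ... | p , t , p-prime , a≡p*t = Kerζ-saturated p {{prime⇒nonZero p-prime}}
    (Kerζ-resp (≈-sym pR≈) (Kerζ-+-closed (Kerζ-*-closedˡ U R[X^d-1]∈) (Kerζ-*-closedˡ R G∈Kerζ)))
    where
    N≡[d*t]*p : N ≡ (d * t) * p
    N≡[d*t]*p = trans N≡a*d (trans (cong (_* d) a≡p*t) (reassoc p t d))
      where
      reassoc : ∀ p t d → p * t * d ≡ d * t * p
      reassoc = ℕ-Solver.solve-∀
    G = geometricSum (mono (d * t)) p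
    U = negP (geometricSum (mono d) t ⊛ geometricSums (mono (d * t)) p)
    G∈Kerζ : Kerζ G
    G∈Kerζ = Kerζ-geometricSum p-prime N≡[d*t]*p
    pR≈ : const (+ p) ⊛ R ≈ (U ⊛ (R ⊛ XdMinus1 d)) ⊕ (R ⊛ G)
    pR≈ = ≈-trans (⊛-congˡ R (const≈XdMinus1-multiple⊕geometricSum d t p)) (regroup (XdMinus1 d) U G R)
      where
      regroup : ∀ X U G R → ((X ⊛ U) ⊕ G) ⊛ R ≈ (U ⊛ (R ⊛ X)) ⊕ (R ⊛ G)
      regroup = solve-∀ Poly-ring

  -- The step function of Defs.cycFactors: cycFactors s N = foldr (cycStep s) one (upTo N).
  cycStep : ℤ → ℕ → Poly → Poly
  cycStep s d′ P = if does (suc d′ ∣? N) ∧ does (μ (N ℕ./ suc d′) ℤP.≟ s) then XdMinus1 (suc d′) ⊛ P else P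

  CycFactorCondition : ℤ → ℕ → Set
  CycFactorCondition s d′ = suc d′ ∣ N × μ (N ℕ./ suc d′) ≡ s

  cycStep-cases : ∀ s d′ P →
    (¬ CycFactorCondition s d′ × cycStep s d′ P ≡ P) ⊎
    (CycFactorCondition s d′ × cycStep s d′ P ≡ XdMinus1 (suc d′) ⊛ P)
  cycStep-cases s d′ P = cases (suc d′ ∣? N) (μ (N ℕ./ suc d′) ℤP.≟ s)
    where
    X = XdMinus1 (suc d′)
    cases : (d∣N? : Dec (suc d′ ∣ N)) (μ≡s? : Dec (μ (N ℕ./ suc d′) ≡ s)) →
      (¬ CycFactorCondition s d′ × (if does d∣N? ∧ does μ≡s? then X ⊛ P else P) ≡ P) ⊎
      (CycFactorCondition s d′ × (if does d∣N? ∧ does μ≡s? then X ⊛ P else P) ≡ X ⊛ P)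
    cases (yes d∣N) (yes μ≡s) = inj₂ ((d∣N , μ≡s) , refl)
    cases (yes _)   (no  μ≢s) = inj₁ ((λ (_ , μ≡s) → μ≢s μ≡s) , refl)
    cases (no  d∤N) _         = inj₁ ((λ (d∣N , _) → d∤N d∣N) , refl)

  μ[N/d]≡1 : ∀ d′ → suc d′ ≡ N → μ (N ℕ./ suc d′) ≡ + 1
  μ[N/d]≡1 d′ d≡N = subst (λ n → μ (n ℕ./ suc d′) ≡ + 1) d≡N (cong μ (n/n≡1 (suc d′)))

  Kerζ-cancel-cycDen : ∀ l R → Kerζ (R ⊛ foldr (cycStep (- + 1)) one l) → Kerζ R
  Kerζ-cancel-cycDen []      R R∈ = Kerζ-resp (⊛-identityʳ R) R∈
  Kerζ-cancel-cycDen (d′ ∷ l) R R∈ with cycStep-cases (- + 1) d′ (foldr (cycStep (- + 1)) one l)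
  ... | inj₁ (_ , step≡) = Kerζ-cancel-cycDen l R (subst (λ F → Kerζ (R ⊛ F)) step≡ R∈)
  ... | inj₂ ((d∣N , μ≡-1) , step≡) = Kerζ-cancel-XdMinus1 d∣N d≢N
    (Kerζ-cancel-cycDen l (R ⊛ XdMinus1 (suc d′))
      (Kerζ-resp (≈-sym (⊛-assoc R _ _)) (subst (λ F → Kerζ (R ⊛ F)) step≡ R∈)))
    where
    d≢N : suc d′ ≢ N
    d≢N d≡N = case trans (sym (μ[N/d]≡1 d′ d≡N)) μ≡-1 of λ ()

  cycNum-factor : ∀ l → ℕ.pred N ∈ l → ∃ λ rest → foldr (cycStep (+ 1)) one l ≈ XdMinus1 N ⊛ rest
  cycNum-factor (d′ ∷ l) N-1∈ with cycStep-cases (+ 1) d′ (foldr (cycStep (+ 1)) one l) | N-1∈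
  ... | inj₂ (_ , step≡)  | here refl = foldr (cycStep (+ 1)) one l ,
    subst (λ d → cycStep (+ 1) d′ (foldr (cycStep (+ 1)) one l) ≈ XdMinus1 d ⊛ foldr (cycStep (+ 1)) one l)
          (ℕP.suc-pred N) (≈-reflexive step≡)
  ... | inj₁ (¬cond , _) | here refl =
    ⊥-elim (¬cond (subst (_∣ N) (sym (ℕP.suc-pred N)) ∣-refl , μ[N/d]≡1 (ℕ.pred N) (ℕP.suc-pred N)))
  ... | inj₁ (_ , step≡) | there N-1∈l = let rest , l≈ = cycNum-factor l N-1∈l in
    rest , subst (_≈ XdMinus1 N ⊛ rest) (sym step≡) l≈
  ... | inj₂ (_ , step≡) | there N-1∈l = let rest , l≈ = cycNum-factor l N-1∈l in
    XdMinus1 (suc d′) ⊛ rest ,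
    ≈-trans (≈-reflexive step≡) (≈-trans (⊛-congʳ (XdMinus1 (suc d′)) l≈) (swap (XdMinus1 (suc d′)) (XdMinus1 N) rest))
    where
    swap : ∀ a b r → a ⊛ (b ⊛ r) ≈ b ⊛ (a ⊛ r)
    swap = solve-∀ Poly-ring

  vanishesAtζ⇒Kerζ : ∀ {P} → VanishesAtζ N P → Kerζ P
  vanishesAtζ⇒Kerζ {P} (g , P·den≡g·num) with cycNum-factor (upTo N) N-1∈upTo
    where
    N-1∈upTo : ℕ.pred N ∈ upTo N
    N-1∈upTo = ∈-upTo⁺ (subst (ℕ.pred N <_) (ℕP.suc-pred N) ℕP.≤-refl)
  ... | rest , num≈ = Kerζ-cancel-cycDen (upTo N) P (kerζ 1 (ε ⊛ (g ⊛ rest)) (begin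
    ε ⊛ (one ⊛ (P ⊛ cycDen N))        ≈⟨ ⊛-congʳ ε (⊛-identityˡ (P ⊛ cycDen N)) ⟩
    ε ⊛ (P ⊛ cycDen N)                ≈⟨ ⊛-congʳ ε (coeffwise P·den≡g·num) ⟩
    ε ⊛ (g ⊛ cycNum N)                ≈⟨ ⊛-congʳ ε (⊛-congʳ g num≈) ⟩
    ε ⊛ (g ⊛ (XdMinus1 N ⊛ rest))     ≈⟨ rearrange ε g (XdMinus1 N) rest ⟩
    (ε ⊛ (g ⊛ rest)) ⊛ XdMinus1 N     ∎))
    where
    open PolyReasoning
    rearrange : ∀ ε g X r → ε ⊛ (g ⊛ (X ⊛ r)) ≈ (ε ⊛ (g ⊛ r)) ⊛ X
    rearrange = solve-∀ Poly-ring

  pell-powers : ∀ w → (one ⊕ w) ⊛ (one ⊕ w) ≋ const (+ 2) →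
    ∀ j → let a , b = pell j in (w ⊛ w) ^ₚ j ≋ const (+ a) ⊕ negP (const (+ b) ⊛ (one ⊕ w))
  pell-powers w v²≋2 zero = ≈⇒≋ (trivial (one ⊕ w))
    where
    trivial : ∀ v → one ≈ const (+ 1) ⊕ negP (const (+ 0) ⊛ v)
    trivial = solve-∀ Poly-ring
  pell-powers w v²≋2 (suc j) = begin
    (w ⊛ w) ⊛ ((w ⊛ w) ^ₚ j)
      ≈⟨ *-congˡ-≋ (w ⊛ w) (pell-powers w v²≋2 j) ⟩
    (w ⊛ w) ⊛ (A ⊕ negP (B ⊛ v))
      ≈⟨ ≈-mod-Kerζ ((A ⊕ (c 2 ⊛ B)) ⊕ negP (B ⊛ v)) (difference∈ v²≋2) (step w A B) ⟩
    ((c 3 ⊛ A) ⊕ (c 4 ⊛ B)) ⊕ negP (((c 2 ⊛ A) ⊕ (c 3 ⊛ B)) ⊛ v)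
      ≈⟨ ≈⇒≋ (⊕-cong (≈-sym (const-pos-lin 3 a 4 b)) (negP-cong (⊛-congˡ v (≈-sym (const-pos-lin 2 a 3 b))))) ⟩
    const (+ (3 * a + 4 * b)) ⊕ negP (const (+ (2 * a + 3 * b)) ⊛ v) ∎
    where
    open ≋-Reasoning
    a = proj₁ (pell j)
    b = proj₂ (pell j)
    c : ℕ → Poly
    c m = const (+ m)
    A = c a
    B = c b
    v = one ⊕ w
    step : ∀ w A B → (w ⊛ w) ⊛ (A ⊕ negP (B ⊛ (one ⊕ w))) ≈
                     (((c 3 ⊛ A) ⊕ (c 4 ⊛ B)) ⊕ negP (((c 2 ⊛ A) ⊕ (c 3 ⊛ B)) ⊛ (one ⊕ w))) ⊕
                     (((A ⊕ (c 2 ⊛ B)) ⊕ negP (B ⊛ (one ⊕ w))) ⊛ (((one ⊕ w) ⊛ (one ⊕ w)) ⊕ negP (c 2)))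
    step = solve-∀ Poly-ring

  -- Multiplying A − Bv − 1 by its conjugate A − 1 + Bv leaves the integer pell-defect (suc k).
  [1+w]²≋2⇒[w²]^[1+k]≉1 : ∀ w → (one ⊕ w) ⊛ (one ⊕ w) ≋ const (+ 2) → ∀ k → ¬ (w ⊛ w) ^ₚ suc k ≋ one
  [1+w]²≋2⇒[w²]^[1+k]≉1 w v²≋2 k w²ᵏ≋1 = const∉Kerζ (pell-defect-suc≢0 k) Z∈Kerζ
    where
    a = proj₁ (pell (suc k))
    b = proj₂ (pell (suc k))
    α = + a
    β = + b
    A = const α
    B = const β
    v = one ⊕ w
    A-Bv≋1 : A ⊕ negP (B ⊛ v) ≋ one
    A-Bv≋1 = ≋-trans (≋-sym (pell-powers w v²≋2 (suc k))) w²ᵏ≋1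
    Z = pell-defect (suc k)
    const-Z≈ : const Z ≈ (((A ⊕ negP one) ⊕ (B ⊛ v)) ⊛ ((A ⊕ negP (B ⊛ v)) ⊕ negP one))
                         ⊕ ((B ⊛ B) ⊛ ((v ⊛ v) ⊕ negP (const (+ 2))))
    const-Z≈ = ≈-trans (⊕-cong (const-* (α ℤ.- + 1) (α ℤ.- + 1))
                               (negP-cong (≈-trans (const-* (+ 2) (β ℤ.* β)) (⊛-congʳ (const (+ 2)) (const-* β β)))))
                       (conjugate A B v)
      where
      conjugate : ∀ A B v → ((A ⊕ negP one) ⊛ (A ⊕ negP one)) ⊕ negP (const (+ 2) ⊛ (B ⊛ B)) ≈
                            (((A ⊕ negP one) ⊕ (B ⊛ v)) ⊛ ((A ⊕ negP (B ⊛ v)) ⊕ negP one))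
                            ⊕ ((B ⊛ B) ⊛ ((v ⊛ v) ⊕ negP (const (+ 2))))
      conjugate = solve-∀ Poly-ring
    Z∈Kerζ : Kerζ (const Z)
    Z∈Kerζ = Kerζ-resp (≈-sym const-Z≈) (Kerζ-+-closed
      (Kerζ-*-closedˡ ((A ⊕ negP one) ⊕ (B ⊛ v)) (difference∈ A-Bv≋1))
      (Kerζ-*-closedˡ (B ⊛ B) (difference∈ v²≋2)))

-- Walsh transforms at ζ = e^(2πi/8q)

inner-zerosʳ : ∀ n (x : Vector Bool n) → inner n x (λ _ → false) ≡ false
inner-zerosʳ zero    x = refl
inner-zerosʳ (suc n) x = cong₂ _xor_ (∧-zeroʳ (x Fz)) (inner-zerosʳ n (λ i → x (Fs i)))

inner-∷-zeros : ∀ n b β (v : Vector Bool n) → inner (suc n) (b ∷ᵛ v) (β ∷ᵛ λ _ → false) ≡ b ∧ β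
inner-∷-zeros n b β v = trans (cong ((b ∧ β) xor_) (inner-zerosʳ n v)) (xor-identityʳ (b ∧ β))

sumFin-*0 : ∀ n (g : Fin n → ℕ) → sumFin n (λ i → g i * 0) ≡ 0
sumFin-*0 zero    g = refl
sumFin-*0 (suc n) g = cong₂ _+_ (ℕP.*-zeroʳ (g Fz)) (sumFin-*0 n (λ i → g (Fs i)))

module EighthRootsOfUnity (q : ℕ) .{{_ : NonZero q}} where

  -- Kept opaque: unfolding N = 8 * q inside Kerζ N makes checking definitions by cases very slow.
  opaque
    N : ℕ
    N = 8 * q

    N≡8q : N ≡ 8 * q
    N≡8q = refl

    instance
      N≢0 : NonZero N
      N≢0 = ℕP.m*n≢0 8 q

  open Cyclotomic N public

  infix 30 ω^_
  ω^_ : ℕ → Poly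
  ω^ m = mono (8 * m)

  ω^-+ : ∀ a b → ω^ (a + b) ≈ ω^ a ⊛ ω^ b
  ω^-+ a b = ≈-sym (mono-+-≡ (8 * a) (8 * b) (sym (ℕP.*-distribˡ-+ 8 a b)))

  ω^q≋1 : ω^ q ≋ one
  ω^q≋1 = subst (λ m → mono m ≋ one) N≡8q X^N≋1

  ω^[k*q]≋1 : ∀ k → ω^ (k * q) ≋ one
  ω^[k*q]≋1 k = begin
    mono (8 * (k * q))   ≡⟨ cong mono (trans (reassoc k q) (cong (_* k) (sym N≡8q))) ⟩
    mono (N * k)         ≈⟨ ≈⇒≋ (mono-* N k) ⟩
    mono N ^ₚ k          ≈⟨ ≋1⇒^ₚ≋1 k X^N≋1 ⟩
    one                  ∎
    where
    open ≋-Reasoning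
    reassoc : ∀ k q → 8 * (k * q) ≡ 8 * q * k
    reassoc = ℕ-Solver.solve-∀

  ω^-mod : ∀ m → ω^ (toℕ (m mod q)) ≋ ω^ m
  ω^-mod m = begin
    ω^ (toℕ (m mod q))            ≡⟨ cong ω^_ (FinP.toℕ-fromℕ< (m%n<n m q)) ⟩
    ω^ (m % q)                    ≈⟨ ≈⇒≋ (⊛-identityʳ (ω^ (m % q))) ⟨
    ω^ (m % q) ⊛ one              ≈⟨ *-congˡ-≋ (ω^ (m % q)) (ω^[k*q]≋1 (m / q)) ⟨
    ω^ (m % q) ⊛ ω^ (m / q * q)   ≈⟨ ≈⇒≋ (ω^-+ (m % q) (m / q * q)) ⟨
    ω^ (m % q + m / q * q)        ≡⟨ cong ω^_ (m≡m%n+[m/n]*n m q) ⟨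
    ω^ m                          ∎
    where open ≋-Reasoning

  ζ^[N/2]≋-1 : mono (4 * q) ≋ negP one
  ζ^[N/2]≋-1 =
    mk≋ (Kerζ-resp (expand (mono (4 * q))) (Kerζ-geometricSum {e = 4 * q} prime[2] (trans N≡8q (halve q))))
    where
    halve : ∀ q → 8 * q ≡ 4 * q * 2
    halve = ℕ-Solver.solve-∀
    expand : ∀ w → one ⊕ (w ⊛ (one ⊕ (w ⊛ []))) ≈ w ⊕ negP (negP one)
    expand = solve-∀ Poly-ring

  private
    ζ^q⊛ζ^7q : mono q ⊛ mono (7 * q) ≈ mono N
    ζ^q⊛ζ^7q = mono-+-≡ q (7 * q) (trans (sum q) (sym N≡8q))
      where
      sum : ∀ q → q + 7 * q ≡ 8 * q
      sum = ℕ-Solver.solve-∀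

    ζ^7q⊛ζ^7q : mono (7 * q) ⊛ mono (7 * q) ≈ (mono q ⊛ mono q) ⊛ (mono (4 * q) ⊛ mono N)
    ζ^7q⊛ζ^7q = begin
      mono (7 * q) ⊛ mono (7 * q)                  ≈⟨ mono-+ (7 * q) (7 * q) ⟨
      mono (7 * q + 7 * q)                         ≡⟨ cong mono (regroup q) ⟩
      mono ((q + q) + (4 * q + 8 * q))             ≡⟨ cong (λ m → mono ((q + q) + (4 * q + m))) N≡8q ⟨
      mono ((q + q) + (4 * q + N))                 ≈⟨ mono-+ (q + q) (4 * q + N) ⟩
      mono (q + q) ⊛ mono (4 * q + N)              ≈⟨ ⊛-cong (mono-+ q q) (mono-+ (4 * q) N) ⟩
      (mono q ⊛ mono q) ⊛ (mono (4 * q) ⊛ mono N)  ∎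
      where
      open PolyReasoning
      regroup : ∀ q → 7 * q + 7 * q ≡ (q + q) + (4 * q + 8 * q)
      regroup = ℕ-Solver.solve-∀

  sqrt2²≋2 : sqrt2 q ⊛ sqrt2 q ≋ const (+ 2)
  sqrt2²≋2 = begin
    (a ⊕ b) ⊛ (a ⊕ b)
      ≈⟨ ≈⇒≋ (square a b) ⟩
    (a ⊛ a) ⊕ ((two ⊛ (a ⊛ b)) ⊕ (b ⊛ b))
      ≈⟨ ≈⇒≋ (⊕-cong (≈-refl {a ⊛ a}) (⊕-cong (⊛-congʳ two ζ^q⊛ζ^7q) ζ^7q⊛ζ^7q)) ⟩
    (a ⊛ a) ⊕ ((two ⊛ mono N) ⊕ ((a ⊛ a) ⊛ (mono (4 * q) ⊛ mono N)))
      ≈⟨ +-cong-≋ (≋-refl {a ⊛ a}) (+-cong-≋ (*-congˡ-≋ two X^N≋1) (*-congˡ-≋ (a ⊛ a) (*-cong-≋ ζ^[N/2]≋-1 X^N≋1))) ⟩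
    (a ⊛ a) ⊕ ((two ⊛ one) ⊕ ((a ⊛ a) ⊛ (negP one ⊛ one)))
      ≈⟨ ≈⇒≋ (collapse (a ⊛ a)) ⟩
    two ∎
    where
    open ≋-Reasoning
    a = mono q
    b = mono (7 * q)
    two = const (+ 2)
    square : ∀ a b → (a ⊕ b) ⊛ (a ⊕ b) ≈ (a ⊛ a) ⊕ ((const (+ 2) ⊛ (a ⊛ b)) ⊕ (b ⊛ b))
    square = solve-∀ Poly-ring
    collapse : ∀ x → x ⊕ ((const (+ 2) ⊛ one) ⊕ (x ⊛ (negP one ⊛ one))) ≈ const (+ 2)
    collapse = solve-∀ Poly-ring

  cancel-sqrt2^ : ∀ n x → (sqrt2 q ^ₚ n) ⊛ x ≋ [] → x ≋ []
  cancel-sqrt2^ n x sx≋0 = Kerζ⇒≋0 (Kerζ-saturated (2 ^ n) {{ℕP.m^n≢0 2 n}} (≋0⇒Kerζ 2ⁿx≋0))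
    where
    open ≋-Reasoning
    s = sqrt2 q ^ₚ n
    s²≋2ⁿ : s ⊛ s ≋ const (+ (2 ^ n))
    s²≋2ⁿ = begin
      s ⊛ s                      ≈⟨ ≈⇒≋ (^ₚ-distrib-⊛ (sqrt2 q) (sqrt2 q) n) ⟨
      (sqrt2 q ⊛ sqrt2 q) ^ₚ n   ≈⟨ ^ₚ-cong-≋ n sqrt2²≋2 ⟩
      const (+ 2) ^ₚ n           ≈⟨ ≈⇒≋ (const-^ₚ 2 n) ⟨
      const (+ (2 ^ n))          ∎
    2ⁿx≋0 : const (+ (2 ^ n)) ⊛ x ≋ []
    2ⁿx≋0 = begin
      const (+ (2 ^ n)) ⊛ x      ≈⟨ *-congʳ-≋ x s²≋2ⁿ ⟨
      (s ⊛ s) ⊛ x                ≈⟨ ≈⇒≋ (⊛-assoc s s x) ⟩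
      s ⊛ (s ⊛ x)                ≈⟨ *-congˡ-≋ s sx≋0 ⟩
      s ⊛ []                     ≈⟨ ≈⇒≋ (⊛-zeroʳ s) ⟩
      []                         ∎

  selfDual⇒≋ : ∀ {n f} → SelfDualGBent q n f → ∀ y → walsh q n f y ≋ selfDualRHS q n f y
  selfDual⇒≋ {n} {f} H y = mk≋ (vanishesAtζ⇒Kerζ
    (subst (λ M → VanishesAtζ M (walsh q n f y ⊕ negP (selfDualRHS q n f y))) (sym N≡8q) (H y)))

  χ : Bool → Poly
  χ false = one
  χ true  = negP one

  ζ^[N/2·b]≋χ : ∀ b → mono (4 * q * bit b) ≋ χ b
  ζ^[N/2·b]≋χ false = ≈⇒≋ (≈-reflexive (cong mono (ℕP.*-zeroʳ (4 * q))))
  ζ^[N/2·b]≋χ true  = ≋-trans (≈⇒≋ (≈-reflexive (cong mono (ℕP.*-identityʳ (4 * q))))) ζ^[N/2]≋-1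

  walsh-≋ : ∀ n f y → walsh q n f y ≋ sumPoly (λ x → χ (inner n x y) ⊛ ω^ (toℕ (f x))) (allVecs n)
  walsh-≋ n f y = sumPoly-cong-≋ (allVecs n) λ x → begin
    mono (8 * toℕ (f x) + 4 * q * bit (inner n x y))       ≈⟨ ≈⇒≋ (mono-+ (8 * toℕ (f x)) _) ⟩
    ω^ (toℕ (f x)) ⊛ mono (4 * q * bit (inner n x y))      ≈⟨ *-congˡ-≋ (ω^ (toℕ (f x))) (ζ^[N/2·b]≋χ (inner n x y)) ⟩
    ω^ (toℕ (f x)) ⊛ χ (inner n x y)                       ≈⟨ ≈⇒≋ (⊛-comm (ω^ (toℕ (f x))) (χ (inner n x y))) ⟩
    χ (inner n x y) ⊛ ω^ (toℕ (f x))                       ∎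
    where open ≋-Reasoning

  -- Subtracting the two equations kills A: (1 + w)·(s w c) − (1 − w)·(s c) = s c ((1 + w)² − 2).
  eliminate-A : ∀ w A s c → (one ⊕ (one ⊛ w)) ⊛ A ≋ s ⊛ (one ⊛ c) → (one ⊕ (negP one ⊛ w)) ⊛ A ≋ s ⊛ (w ⊛ c) →
                s ⊛ (c ⊛ (((one ⊕ w) ⊛ (one ⊕ w)) ⊕ negP (const (+ 2)))) ≋ []
  eliminate-A w A s c E₀ E₁ = begin
    s ⊛ (c ⊛ (((one ⊕ w) ⊛ (one ⊕ w)) ⊕ negP (const (+ 2))))
      ≈⟨ ≈⇒≋ (expand w s c) ⟩
    ((one ⊕ w) ⊛ (s ⊛ (w ⊛ c))) ⊕ negP ((one ⊕ negP w) ⊛ (s ⊛ (one ⊛ c)))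
      ≈⟨ +-cong-≋ (*-congˡ-≋ (one ⊕ w) (≋-sym E₁)) (-‿cong-≋ (*-congˡ-≋ (one ⊕ negP w) (≋-sym E₀))) ⟩
    ((one ⊕ w) ⊛ ((one ⊕ (negP one ⊛ w)) ⊛ A)) ⊕ negP ((one ⊕ negP w) ⊛ ((one ⊕ (one ⊛ w)) ⊛ A))
      ≈⟨ ≈⇒≋ (cancel w A) ⟩
    [] ∎
    where
    open ≋-Reasoning
    expand : ∀ w s c → s ⊛ (c ⊛ (((one ⊕ w) ⊛ (one ⊕ w)) ⊕ negP (const (+ 2)))) ≈
                       ((one ⊕ w) ⊛ (s ⊛ (w ⊛ c))) ⊕ negP ((one ⊕ negP w) ⊛ (s ⊛ (one ⊛ c)))
    expand = solve-∀ Poly-ring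
    cancel : ∀ w A → ((one ⊕ w) ⊛ ((one ⊕ (negP one ⊛ w)) ⊛ A)) ⊕ negP ((one ⊕ negP w) ⊛ ((one ⊕ (one ⊛ w)) ⊛ A))
                     ≈ []
    cancel = solve-∀ Poly-ring

  module Affine (n′ : ℕ) (λ₀ : Fin q) (λs : Fin (suc n′) → Fin q) where

    f : Vector Bool (suc n′) → Fin q
    f = affine q (suc n′) λ₀ λs

    zeros : Vector Bool n′
    zeros _ = false

    a₀ a₁ : ℕ
    a₀ = toℕ λ₀
    a₁ = toℕ (λs Fz)

    S : Vector Bool n′ → ℕ
    S v = sumFin n′ (λ i → toℕ (λs (Fs i)) * bit (v i))

    w c A : Poly
    w = ω^ a₁
    c = ω^ a₀
    A = sumPoly (λ v → ω^ (S v + a₀)) (allVecs n′)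

    ω^f : ∀ b v → ω^ (toℕ (f (b ∷ᵛ v))) ≋ ω^ (a₁ * bit b) ⊛ ω^ (S v + a₀)
    ω^f b v = begin
      ω^ (toℕ (f (b ∷ᵛ v)))           ≈⟨ ω^-mod (a₁ * bit b + S v + a₀) ⟩
      ω^ (a₁ * bit b + S v + a₀)      ≡⟨ cong ω^_ (ℕP.+-assoc (a₁ * bit b) (S v) a₀) ⟩
      ω^ (a₁ * bit b + (S v + a₀))    ≈⟨ ≈⇒≋ (ω^-+ (a₁ * bit b) (S v + a₀)) ⟩
      ω^ (a₁ * bit b) ⊛ ω^ (S v + a₀) ∎
      where open ≋-Reasoning

    ω^[a₁·0]≈1 : ω^ (a₁ * 0) ≈ one
    ω^[a₁·0]≈1 = ≈-reflexive (cong ω^_ (ℕP.*-zeroʳ a₁))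

    ω^[a₁·1]≈w : ω^ (a₁ * 1) ≈ w
    ω^[a₁·1]≈w = ≈-reflexive (cong ω^_ (ℕP.*-identityʳ a₁))

    walsh-at-β∷zeros : ∀ β → walsh q (suc n′) f (β ∷ᵛ zeros) ≋ (one ⊕ (χ β ⊛ w)) ⊛ A
    walsh-at-β∷zeros β = begin
      walsh q (suc n′) f y                                               ≈⟨ walsh-≋ (suc n′) f y ⟩
      sumPoly g (allVecs (suc n′))                                       ≈⟨ ≈⇒≋ (sumPoly-pairs g (false ∷ᵛ_) (true ∷ᵛ_) (allVecs n′)) ⟩
      sumPoly (λ v → g (false ∷ᵛ v) ⊕ g (true ∷ᵛ v)) (allVecs n′)        ≈⟨ sumPoly-cong-≋ (allVecs n′) pair ⟩
      sumPoly (λ v → (one ⊕ (χ β ⊛ w)) ⊛ ω^ (S v + a₀)) (allVecs n′)     ≈⟨ ≈⇒≋ (sumPoly-⊛ (one ⊕ (χ β ⊛ w)) _ (allVecs n′)) ⟩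
      (one ⊕ (χ β ⊛ w)) ⊛ A                                             ∎
      where
      open ≋-Reasoning
      y = β ∷ᵛ zeros
      g : Vector Bool (suc n′) → Poly
      g x = χ (inner (suc n′) x y) ⊛ ω^ (toℕ (f x))
      pair : ∀ v → g (false ∷ᵛ v) ⊕ g (true ∷ᵛ v) ≋ (one ⊕ (χ β ⊛ w)) ⊛ ω^ (S v + a₀)
      pair v = begin
        g (false ∷ᵛ v) ⊕ g (true ∷ᵛ v)
          ≡⟨ cong₂ (λ s t → (χ s ⊛ ω^ (toℕ (f (false ∷ᵛ v)))) ⊕ (χ t ⊛ ω^ (toℕ (f (true ∷ᵛ v)))))
                   (inner-∷-zeros n′ false β v) (inner-∷-zeros n′ true β v) ⟩
        (one ⊛ ω^ (toℕ (f (false ∷ᵛ v)))) ⊕ (χ β ⊛ ω^ (toℕ (f (true ∷ᵛ v))))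
          ≈⟨ +-cong-≋ (*-congˡ-≋ one (ω^f false v)) (*-congˡ-≋ (χ β) (ω^f true v)) ⟩
        (one ⊛ (ω^ (a₁ * 0) ⊛ Av)) ⊕ (χ β ⊛ (ω^ (a₁ * 1) ⊛ Av))
          ≈⟨ ≈⇒≋ (⊕-cong (⊛-congʳ one (⊛-congˡ Av ω^[a₁·0]≈1)) (⊛-congʳ (χ β) (⊛-congˡ Av ω^[a₁·1]≈w))) ⟩
        (one ⊛ (one ⊛ Av)) ⊕ (χ β ⊛ (w ⊛ Av))
          ≈⟨ ≈⇒≋ (factor (χ β) w Av) ⟩
        (one ⊕ (χ β ⊛ w)) ⊛ Av ∎
        where
        Av = ω^ (S v + a₀)
        factor : ∀ χ w A → (one ⊛ (one ⊛ A)) ⊕ (χ ⊛ (w ⊛ A)) ≈ (one ⊕ (χ ⊛ w)) ⊛ A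
        factor = solve-∀ Poly-ring

    ω^f[β∷zeros] : ∀ β → ω^ (toℕ (f (β ∷ᵛ zeros))) ≋ ω^ (a₁ * bit β) ⊛ c
    ω^f[β∷zeros] β = begin
      ω^ (toℕ (f (β ∷ᵛ zeros)))              ≈⟨ ω^f β zeros ⟩
      ω^ (a₁ * bit β) ⊛ ω^ (S zeros + a₀)    ≡⟨ cong (λ m → ω^ (a₁ * bit β) ⊛ ω^ (m + a₀)) (sumFin-*0 n′ (toℕ ∘ λs ∘ Fs)) ⟩
      ω^ (a₁ * bit β) ⊛ c                    ∎
      where open ≋-Reasoning

    ω^a₀-invertible : c ⊛ ω^ (q ∸ a₀) ≋ one
    ω^a₀-invertible = begin
      ω^ a₀ ⊛ ω^ (q ∸ a₀)   ≈⟨ ≈⇒≋ (ω^-+ a₀ (q ∸ a₀)) ⟨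
      ω^ (a₀ + (q ∸ a₀))    ≡⟨ cong ω^_ (ℕP.m+[n∸m]≡n (ℕP.<⇒≤ (FinP.toℕ<n λ₀))) ⟩
      ω^ q                  ≈⟨ ω^q≋1 ⟩
      one                   ∎
      where open ≋-Reasoning

    selfDual⇒[1+w]²≋2 : SelfDualGBent q (suc n′) f → (one ⊕ w) ⊛ (one ⊕ w) ≋ const (+ 2)
    selfDual⇒[1+w]²≋2 H = mk≋ (≋0⇒Kerζ (cancel-unit c (ω^ (q ∸ a₀)) _ ω^a₀-invertible
      (cancel-sqrt2^ (suc n′) _ (eliminate-A w A s c (dual false ω^[a₁·0]≈1) (dual true ω^[a₁·1]≈w)))))
      where
      s = sqrt2 q ^ₚ suc n′
      dual : ∀ β {u} → ω^ (a₁ * bit β) ≈ u → (one ⊕ (χ β ⊛ w)) ⊛ A ≋ s ⊛ (u ⊛ c)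
      dual β ω^≈u = ≋-trans (≋-sym (walsh-at-β∷zeros β))
        (≋-trans (selfDual⇒≋ {f = f} H (β ∷ᵛ zeros))
                 (*-congˡ-≋ s (≋-trans (ω^f[β∷zeros] β) (≈⇒≋ (⊛-congˡ c ω^≈u)))))

    [w²]^k≋1 : ∀ k → q ≡ k * 2 → (w ⊛ w) ^ₚ k ≋ one
    [w²]^k≋1 k q≡k*2 = begin
      (w ⊛ w) ^ₚ k            ≈⟨ ^ₚ-cong-≋ k (≈⇒≋ (≈-sym (ω^-+ a₁ a₁))) ⟩
      ω^ (a₁ + a₁) ^ₚ k        ≈⟨ ≈⇒≋ (mono-* (8 * (a₁ + a₁)) k) ⟨
      mono (8 * (a₁ + a₁) * k) ≡⟨ cong mono (reassoc a₁ k) ⟩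
      ω^ (a₁ * (k * 2))        ≡⟨ cong (λ m → ω^ (a₁ * m)) q≡k*2 ⟨
      ω^ (a₁ * q)              ≈⟨ ω^[k*q]≋1 a₁ ⟩
      one                      ∎
      where
      open ≋-Reasoning
      reassoc : ∀ a k → 8 * (a + a) * k ≡ 8 * (a * (k * 2))
      reassoc = ℕ-Solver.solve-∀

theorem5 : (q n : ℕ) .{{_ : NonZero q}} → 2 ≤ q → 2 ∣ q → 1 ≤ n →
    (λ₀ : Fin q) (λs : Fin n → Fin q) → ¬ SelfDualGBent q n (affine q n λ₀ λs)
-- The hypothesis 2 ≤ q already follows from NonZero q and 2 ∣ q.
theorem5 q (suc n′) _ (divides zero    q≡0)     _ λ₀ λs H = ℕ.≢-nonZero⁻¹ q q≡0
theorem5 q (suc n′) _ (divides (suc k) q≡k+1*2) _ λ₀ λs H =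
  [1+w]²≋2⇒[w²]^[1+k]≉1 w (selfDual⇒[1+w]²≋2 H) k ([w²]^k≋1 (suc k) q≡k+1*2)
  where
  open EighthRootsOfUnity q
  open Affine n′ λ₀ λs
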